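{- Let $\pi=(d_1,\dots,d_n)$ be the degree sequence of a tree with $d_1\ge\cdots\ge d_k\ge 2$, $d_{k+1}=\cdots=d_n=1$, and let $T=C(y_1,\dots,y_k)\in\mathcal{C}_\pi$ with spine $v_0v_1\cdots v_{k+1}$. Suppose there exist an integer $p$ with $2\le p\le k-1$ and a positive integer $q\le\min\{k-p,\,p-1\}$ such that $f_{V_{p-i}}(v_{p-i})\ge f_{V_{p+i}}(v_{p+i})$ for all $i=1,\dots,q$, with at least one of these inequalities strict, and $f_{V_{\le p-q-1}}(v_{p-q-1})> f_{V_{\ge p+q+1}}(v_{p+q+1})$. Then there exists a caterpillar $T_1\in\mathcal{C}_\pi$ with $\varphi(T_1)<\varphi(T)$.
   Context: A subtree of a tree is a nonempty connected subgraph; $\varphi(T)$ is the number of nonempty subtrees of $T$, and for a tree $H$ and a vertex $v$ of $H$, $f_H(v)$ is the number of subtrees of $H$ containing $v$. A caterpillar is a tree containing a path such that every vertex not on the path is adjacent to a vertex on the path. $\mathcal{C}_\pi$ is the set of caterpillars with degree sequence $\pi$. For a permutation $(y_1,\dots,y_k)$ of $(d_1-2,\dots,d_k-2)$, $C(y_1,\dots,y_k)$ is the caterpillar obtained from a path $v_0v_1\cdots v_kv_{k+1}$ by attaching $y_j$ new pendant vertices to $v_j$ for $j=1,\dots,k$ (the path is called the spine); every member of $\mathcal{C}_\pi$ is of this form. For $1\le j\le k$: $V_j$ is the component containing $v_j$ of $C(y_1,\dots,y_k)$ minus the two edges $v_{j-1}v_j$ and $v_jv_{j+1}$; $V_{\ge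 j}$ is the component containing $v_j$ after deleting the edge $v_{j-1}v_j$; $V_{\le j}$ is the component containing $v_j$ after deleting the edge $v_jv_{j+1}$. By convention $V_0=V_{\le 0}=\{v_0\}$ and $V_{k+1}=V_{\ge k+1}=\{v_{k+1}\}$ (single-vertex trees). -}

module Defs where

open import Data.Nat using (ℕ; zero; suc; _+_; _∸_; _≡ᵇ_; _≤ᵇ_)
open import Data.Bool using (Bool; true; false; _∧_; _∨_; not; if_then_else_)
open import Data.List using (List; []; _∷_; _++_; map; concatMap; upTo; length; filterᵇ)
open import Data.Bool.ListAction using (any; all)

-- Vertices of a caterpillar C(y₁,…,y_k):
--   sp i    = spine vertex v_i            (0 ≤ i ≤ k+1)
--   lf j t  = t-th pendant vertex at v_j  (1 ≤ j ≤ k, 0 ≤ t < y_j)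
data Vtx : Set where
  sp : ℕ → Vtx
  lf : ℕ → ℕ → Vtx

_==_ : Vtx → Vtx → Bool
sp i   == sp j   = i ≡ᵇ j
sp _   == lf _ _ = false
lf _ _ == sp _   = false
lf i s == lf j t = (i ≡ᵇ j) ∧ (s ≡ᵇ t)

-- y_j (1-based index into the list y = (y₁,…,y_k)); 0 outside 1..k
yAt : List ℕ → ℕ → ℕ
yAt []       _             = 0
yAt (_ ∷ _)  zero          = 0
yAt (x ∷ _)  (suc zero)    = x
yAt (_ ∷ xs) (suc (suc j)) = yAt xs (suc j)

vertices : List ℕ → List Vtx
vertices y =
  map sp (upTo (length y + 2))
  ++ concatMap (λ i → map (lf (suc i)) (upTo (yAt y (suc i)))) (upTo (length y))

adj : Vtx → Vtx → Bool
adj (sp i)   (sp j)   = ((i + 1) ≡ᵇ j) ∨ ((j + 1) ≡ᵇ i)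
adj (sp i)   (lf j _) = i ≡ᵇ j
adj (lf j _) (sp i)   = i ≡ᵇ j
adj (lf _ _) (lf _ _) = false

elem : Vtx → List Vtx → Bool
elem v = any (v ==_)

sublists : {A : Set} → List A → List (List A)
sublists []       = [] ∷ []
sublists (x ∷ xs) = map (x ∷_) (sublists xs) ++ sublists xs

grow : List Vtx → List Vtx → List Vtx
grow S R = R ++ filterᵇ (λ w → any (adj w) R ∧ not (elem w R)) S

iter : ℕ → List Vtx → List Vtx → List Vtx
iter zero    S R = R
iter (suc n) S R = iter n S (grow S R)

-- S is a nonempty vertex set inducing a connected subgraph of C(y)
-- (everything in S is reachable from its first vertex through vertices of S)
isSubtree : List Vtx → Bool
isSubtree []      = false
isSubtree (v ∷ S) = all (λ w → elem w (iter (length (v ∷ S)) (v ∷ S) (v ∷ []))) (v ∷ S)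

subtrees : List ℕ → List (List Vtx)
subtrees y = filterᵇ isSubtree (sublists (vertices y))

φ : List ℕ → ℕ
φ y = length (subtrees y)

-- f_H(v) for H the subgraph of C(y) induced by the vertex region W:
-- the number of subtrees of H containing v
f : List ℕ → (Vtx → Bool) → Vtx → ℕ
f y W v = length (filterᵇ (λ S → elem v S ∧ all W S) (subtrees y))

V : ℕ → Vtx → Bool
V j (sp i)   = i ≡ᵇ j
V j (lf i _) = i ≡ᵇ j

V≤ : ℕ → Vtx → Bool
V≤ j (sp i)   = i ≤ᵇ j
V≤ j (lf i _) = i ≤ᵇ j

V≥ : ℕ → Vtx → Bool
V≥ j (sp i)   = j ≤ᵇ i
V≥ j (lf i _) = j ≤ᵇ i

-- A subtree of the caterpillar C(y₁,…,y_k) is either a single pendant vertex or consists of a spine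
-- interval v_l ⋯ v_g together with any set of pendant vertices attached to v_l, …, v_g.  With the
-- weights a_j = 2^{y_j} (and a₀ = a_{k+1} = 1) this gives φ = Σ y_j + Σ_{l ≤ g} a_l ⋯ a_g, and in
-- the same way f_{V_j}(v_j) = a_j, f_{V≤m}(v_m) = Σ_{l ≤ m} a_l ⋯ a_m and f_{V≥m}(v_m) = Σ_{g ≥ m} a_m ⋯ a_g.
-- Write the weight sequence as X M Z with M = a_{p-q} ⋯ a_{p+q}, and let T₁ be C(y) with the block
-- of y under M reversed.  Writing pre and suf for the sums of the products of the nonempty prefixes
-- and suffixes of a list, only the segments meeting both M and X or Z change, and
-- φ(T) − φ(T₁) = (pre M − suf M)(suf X − pre Z).  The last hypothesis says suf X > pre Z, and the
-- comparisons a_{p-i} ≥ a_{p+i}, one of them strict, give pre M > suf M by peeling off the outer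
-- pair of M one radius at a time.

module Submission where

open import Data.Bool using (Bool; true; false; T; T?; _∧_; not; if_then_else_)
open import Data.Bool.ListAction using (any; all)
open import Data.Bool.Properties using (T-≡; T-not-≡; T-∧; T-∨; ∧-identityʳ; ∧-zeroʳ)
open import Data.Empty using (⊥; ⊥-elim)
open import Data.List using (List; []; _∷_; _++_; length; map; filterᵇ; null; applyUpTo; upTo; concatMap; reverse)
open import Data.List.Membership.Propositional using (_∈_; lose; find)
open import Data.List.Membership.Propositional.Properties
  using (∈-++⁻; ∈-++⁺ˡ; ∈-++⁺ʳ; ∈-map⁻; ∈-filter⁺; ∈-filter⁻; ∈-concatMap⁻)
open import Data.List.Properties
  using (map-++; map-∘; map-id; map-cong; map-cong-local; length-++-≤ˡ; length-applyUpTo; length-map;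
         unfold-reverse; reverse-map; ++-assoc)
open import Data.List.Relation.Binary.Disjoint.Propositional using (Disjoint)
open import Data.List.Relation.Binary.Permutation.Propositional using (_↭_; ↭-trans)
open import Data.List.Relation.Binary.Permutation.Propositional.Properties using (↭-reverse; ++⁺ˡ; ++⁺ʳ; ↭-length)
open import Data.List.Relation.Unary.All using (All)
import Data.List.Relation.Unary.All as All
open import Data.List.Relation.Unary.All.Properties using (all⁺; all⁻)
import Data.List.Relation.Unary.All.Properties as All
import Data.List.Relation.Unary.AllPairs as AllPairs
import Data.List.Relation.Unary.AllPairs.Properties as AllPairs
open import Data.List.Relation.Unary.Any as Any using (here; there)
open import Data.List.Relation.Unary.Any.Properties using (any⁺; any⁻)
open import Data.List.Relation.Unary.Linked using (Linked)
open import Data.List.Relation.Unary.Unique.Propositional using (Unique)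
import Data.List.Relation.Unary.Unique.Propositional.Properties as Unique
open import Data.Nat using (ℕ; zero; suc; _+_; _∸_; _*_; _^_; _≤_; _<_; _≥_; _>_; _⊓_; _≡ᵇ_; _≤ᵇ_; z≤n; s≤s; >-nonZero)
open import Data.Nat.ListAction using (sum; product)
open import Data.Nat.ListAction.Properties using (sum-++; sum-↭; product-++; product-↭)
open import Data.Nat.Properties
open import Algebra.Properties.CommutativeSemigroup +-commutativeSemigroup using (interchange)
open import Data.Nat.Tactic.RingSolver using (solve-∀)
open import Data.Product using (_×_; _,_; proj₁; proj₂; ∃; ∃-syntax)
open import Data.Sum using (_⊎_; inj₁; inj₂)
open import Data.Unit using (⊤)
open import Function using (_∘_; id; _⇔_; mk⇔; Equivalence)
open import Relation.Binary using (tri<; tri≈; tri>)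
open import Relation.Binary.PropositionalEquality
  using (_≡_; _≢_; refl; sym; trans; cong; cong₂; subst; subst₂; ≢-sym; module ≡-Reasoning)
open import Relation.Nullary using (¬_; yes; no)

open import Defs

private variable A B : Set

T-ext : {a b : Bool} → (T a → T b) → (T b → T a) → a ≡ b
T-ext {true}  {true}  _ _ = refl
T-ext {true}  {false} f _ = ⊥-elim (f _)
T-ext {false} {true}  _ g = ⊥-elim (g _)
T-ext {false} {false} _ _ = refl

T⇒≡true : {b : Bool} → T b → b ≡ true
T⇒≡true = Equivalence.to T-≡

≡true⇒T : {b : Bool} → b ≡ true → T b
≡true⇒T = Equivalence.from T-≡

¬T⇒≡false : {b : Bool} → ¬ T b → b ≡ false
¬T⇒≡false {true}  ¬b = ⊥-elim (¬b _)
¬T⇒≡false {false} ¬b = refl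

T-∧⁺ : {a b : Bool} → T a → T b → T (a ∧ b)
T-∧⁺ ta tb = Equivalence.from T-∧ (ta , tb)

T-∧⁻ : {a b : Bool} → T (a ∧ b) → T a × T b
T-∧⁻ = Equivalence.to T-∧

if-∧ : (a b : Bool) (x : ℕ) → (if a ∧ b then x else 0) ≡ (if a then (if b then x else 0) else 0)
if-∧ true  b x = refl
if-∧ false b x = refl

≡ᵇ-true : {m n : ℕ} → m ≡ n → (m ≡ᵇ n) ≡ true
≡ᵇ-true {m} {n} m≡n = T⇒≡true (≡⇒≡ᵇ m n m≡n)

≡ᵇ-false : {m n : ℕ} → m ≢ n → (m ≡ᵇ n) ≡ false
≡ᵇ-false {m} {n} m≢n = ¬T⇒≡false (m≢n ∘ ≡ᵇ⇒≡ m n)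

≤ᵇ-true : {m n : ℕ} → m ≤ n → (m ≤ᵇ n) ≡ true
≤ᵇ-true m≤n = T⇒≡true (≤⇒≤ᵇ m≤n)

≤ᵇ-false : {m n : ℕ} → ¬ m ≤ n → (m ≤ᵇ n) ≡ false
≤ᵇ-false {m} {n} m≰n = ¬T⇒≡false (m≰n ∘ ≤ᵇ⇒≤ m n)

==⇒≡ : (u w : Vtx) → T (u == w) → u ≡ w
==⇒≡ (sp i)   (sp j)   i≡j = cong sp (≡ᵇ⇒≡ i j i≡j)
==⇒≡ (lf i s) (lf j t) eq  with T-∧⁻ eq
... | i≡j , s≡t = cong₂ lf (≡ᵇ⇒≡ i j i≡j) (≡ᵇ⇒≡ s t s≡t)

==-refl : (w : Vtx) → T (w == w)
==-refl (sp i)   = ≡⇒≡ᵇ i i refl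
==-refl (lf i t) = T-∧⁺ (≡⇒≡ᵇ i i refl) (≡⇒≡ᵇ t t refl)

elem⇒∈ : {w : Vtx} (R : List Vtx) → T (elem w R) → w ∈ R
elem⇒∈ {w} R w∈ = Any.map (==⇒≡ w _) (any⁻ (w ==_) R w∈)

∈⇒elem : {w : Vtx} {R : List Vtx} → w ∈ R → T (elem w R)
∈⇒elem {w} w∈R = any⁺ (w ==_) (lose w∈R (==-refl w))

count : (A → Bool) → List A → ℕ
count p xs = length (filterᵇ p xs)

count-∷ : (p : A → Bool) (x : A) (xs : List A) → count p (x ∷ xs) ≡ (if p x then 1 else 0) + count p xs
count-∷ p x xs with p x
... | true  = refl
... | false = refl

count-++ : (p : A → Bool) (xs ys : List A) → count p (xs ++ ys) ≡ count p xs + count p ys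
count-++ p []       ys = refl
count-++ p (x ∷ xs) ys with p x
... | true  = cong suc (count-++ p xs ys)
... | false = count-++ p xs ys

count-map : (p : B → Bool) (f : A → B) (xs : List A) → count p (map f xs) ≡ count (p ∘ f) xs
count-map p f []       = refl
count-map p f (x ∷ xs) with p (f x)
... | true  = cong suc (count-map p f xs)
... | false = count-map p f xs

count-cong : (p q : A → Bool) (xs : List A) → (∀ x → x ∈ xs → p x ≡ q x) → count p xs ≡ count q xs
count-cong p q []       eq = refl
count-cong p q (x ∷ xs) eq = begin
  count p (x ∷ xs)                            ≡⟨ count-∷ p x xs ⟩
  (if p x then 1 else 0) + count p xs         ≡⟨ cong₂ (λ b n → (if b then 1 else 0) + n) (eq x (here refl))
                                                   (count-cong p q xs (λ z z∈xs → eq z (there z∈xs))) ⟩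
  (if q x then 1 else 0) + count q xs         ≡⟨ count-∷ q x xs ⟨
  count q (x ∷ xs)                            ∎
  where open ≡-Reasoning

count-none : (p : A → Bool) (xs : List A) → (∀ x → x ∈ xs → p x ≡ false) → count p xs ≡ 0
count-none p []       none = refl
count-none p (x ∷ xs) none rewrite none x (here refl) = count-none p xs (λ z z∈xs → none z (there z∈xs))

count-filterᵇ : (p q : A → Bool) (xs : List A) → count p (filterᵇ q xs) ≡ count (λ x → q x ∧ p x) xs
count-filterᵇ p q []       = refl
count-filterᵇ p q (x ∷ xs) with q x
... | false = count-filterᵇ p q xs
... | true with p x
...   | true  = cong suc (count-filterᵇ p q xs)
...   | false = count-filterᵇ p q xs

count-concatMap : (p : B → Bool) (f : A → List B) (xs : List A) → count p (concatMap f xs) ≡ sum (map (count p ∘ f) xs)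
count-concatMap p f []       = refl
count-concatMap p f (x ∷ xs) = trans (count-++ p (f x) (concatMap f xs)) (cong (count p (f x) +_) (count-concatMap p f xs))

count-const : (b : Bool) (xs : List A) → count (λ _ → b) xs ≡ (if b then length xs else 0)
count-const true  []       = refl
count-const true  (x ∷ xs) = cong suc (count-const true xs)
count-const false []       = refl
count-const false (x ∷ xs) = count-const false xs

count≡sum : (p : A → Bool) (xs : List A) → count p xs ≡ sum (map (λ x → if p x then 1 else 0) xs)
count≡sum p []       = refl
count≡sum p (x ∷ xs) = trans (count-∷ p x xs) (cong ((if p x then 1 else 0) +_) (count≡sum p xs))

sum-map-++ : (g : A → ℕ) (xs ys : List A) → sum (map g (xs ++ ys)) ≡ sum (map g xs) + sum (map g ys)
sum-map-++ g xs ys = trans (cong sum (map-++ g xs ys)) (sum-++ (map g xs) (map g ys))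

sum-map-∘ : (g : B → ℕ) (f : A → B) (xs : List A) → sum (map g (map f xs)) ≡ sum (map (g ∘ f) xs)
sum-map-∘ g f xs = cong sum (sym (map-∘ xs))

sum-map-cong : (g h : A → ℕ) (xs : List A) → (∀ x → x ∈ xs → g x ≡ h x) → sum (map g xs) ≡ sum (map h xs)
sum-map-cong g h []       eq = refl
sum-map-cong g h (x ∷ xs) eq = cong₂ _+_ (eq x (here refl)) (sum-map-cong g h xs (λ z z∈xs → eq z (there z∈xs)))

sum-map-zero : (g : A → ℕ) (xs : List A) → (∀ x → x ∈ xs → g x ≡ 0) → sum (map g xs) ≡ 0
sum-map-zero g []       eq = refl
sum-map-zero g (x ∷ xs) eq = cong₂ _+_ (eq x (here refl)) (sum-map-zero g xs (λ z z∈xs → eq z (there z∈xs)))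

sum-map-+ : (g h : A → ℕ) (xs : List A) → sum (map (λ x → g x + h x) xs) ≡ sum (map g xs) + sum (map h xs)
sum-map-+ g h []       = refl
sum-map-+ g h (x ∷ xs) = trans (cong (g x + h x +_) (sum-map-+ g h xs)) (interchange (g x) (h x) _ _)

sum-map-*ˡ : (c : ℕ) (g : A → ℕ) (xs : List A) → sum (map (λ x → c * g x) xs) ≡ c * sum (map g xs)
sum-map-*ˡ c g []       = sym (*-zeroʳ c)
sum-map-*ˡ c g (x ∷ xs) = trans (cong (c * g x +_) (sum-map-*ˡ c g xs)) (sym (*-distribˡ-+ c (g x) _))

count-sublists-++ : (P : List A → Bool) (xs ys : List A) →
  count P (sublists (xs ++ ys)) ≡ sum (map (λ s → count (λ t → P (s ++ t)) (sublists ys)) (sublists xs))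
count-sublists-++ P []       ys = sym (+-identityʳ _)
count-sublists-++ P (x ∷ xs) ys = begin
  count P (map (x ∷_) (sublists (xs ++ ys)) ++ sublists (xs ++ ys))
    ≡⟨ count-++ P (map (x ∷_) (sublists (xs ++ ys))) (sublists (xs ++ ys)) ⟩
  count P (map (x ∷_) (sublists (xs ++ ys))) + count P (sublists (xs ++ ys))
    ≡⟨ cong₂ _+_ (trans (count-map P (x ∷_) (sublists (xs ++ ys))) (count-sublists-++ (P ∘ (x ∷_)) xs ys))
                 (count-sublists-++ P xs ys) ⟩
  sum (map (G ∘ (x ∷_)) (sublists xs)) + sum (map G (sublists xs))
    ≡⟨ cong (_+ sum (map G (sublists xs))) (sum-map-∘ G (x ∷_) (sublists xs)) ⟨
  sum (map G (map (x ∷_) (sublists xs))) + sum (map G (sublists xs))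
    ≡⟨ sum-map-++ G (map (x ∷_) (sublists xs)) (sublists xs) ⟨
  sum (map G (map (x ∷_) (sublists xs) ++ sublists xs)) ∎
  where
  open ≡-Reasoning
  G : List _ → ℕ
  G s = count (λ t → P (s ++ t)) (sublists ys)

count-all-sublists : (q : A → Bool) (xs : List A) → count (all q) (sublists xs) ≡ 2 ^ count q xs
count-all-sublists q []       = refl
count-all-sublists q (x ∷ xs) with q x in qx
... | true  = begin
  count (all q) (map (x ∷_) (sublists xs) ++ sublists xs)
    ≡⟨ count-++ (all q) (map (x ∷_) (sublists xs)) (sublists xs) ⟩
  count (all q) (map (x ∷_) (sublists xs)) + count (all q) (sublists xs)
    ≡⟨ cong (_+ count (all q) (sublists xs))
            (trans (count-map (all q) (x ∷_) (sublists xs))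
                   (count-cong _ (all q) (sublists xs) (λ t _ → cong (_∧ all q t) qx))) ⟩
  count (all q) (sublists xs) + count (all q) (sublists xs)
    ≡⟨ cong (λ n → n + n) (count-all-sublists q xs) ⟩
  2 ^ count q xs + 2 ^ count q xs
    ≡⟨ cong (2 ^ count q xs +_) (+-identityʳ _) ⟨
  2 ^ suc (count q xs) ∎
  where open ≡-Reasoning
... | false = begin
  count (all q) (map (x ∷_) (sublists xs) ++ sublists xs)
    ≡⟨ count-++ (all q) (map (x ∷_) (sublists xs)) (sublists xs) ⟩
  count (all q) (map (x ∷_) (sublists xs)) + count (all q) (sublists xs)
    ≡⟨ cong (_+ count (all q) (sublists xs))
            (trans (count-map (all q) (x ∷_) (sublists xs))
                   (count-none _ (sublists xs) (λ t _ → cong (_∧ all q t) qx))) ⟩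
  count (all q) (sublists xs)
    ≡⟨ count-all-sublists q xs ⟩
  2 ^ count q xs ∎
  where open ≡-Reasoning

count-all-∧-sublists : (q : A → Bool) (b : Bool) (xs : List A) →
  count (λ t → all q t ∧ b) (sublists xs) ≡ (if b then 2 ^ count q xs else 0)
count-all-∧-sublists q true  xs = trans (count-cong _ (all q) (sublists xs) (λ t _ → ∧-identityʳ (all q t)))
                                        (count-all-sublists q xs)
count-all-∧-sublists q false xs = count-none _ (sublists xs) (λ t _ → ∧-zeroʳ (all q t))

∈-sublists⁻ : {xs t : List A} {z : A} → t ∈ sublists xs → z ∈ t → z ∈ xs
∈-sublists⁻ {xs = []}     (here refl) ()
∈-sublists⁻ {xs = x ∷ xs} t∈ z∈t with ∈-++⁻ (map (x ∷_) (sublists xs)) t∈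
... | inj₂ t∈′ = there (∈-sublists⁻ t∈′ z∈t)
... | inj₁ t∈′ with ∈-map⁻ (x ∷_) t∈′
...   | _ , t′∈ , refl with z∈t
...     | here refl = here refl
...     | there z∈t′ = there (∈-sublists⁻ t′∈ z∈t′)

sum-sublists-[] : (g : List A → ℕ) (xs : List A) → (∀ {x} t → x ∈ xs → g (x ∷ t) ≡ 0) → sum (map g (sublists xs)) ≡ g []
sum-sublists-[] g []       g∷ = +-identityʳ (g [])
sum-sublists-[] g (x ∷ xs) g∷ = begin
  sum (map g (map (x ∷_) (sublists xs) ++ sublists xs))
    ≡⟨ sum-map-++ g (map (x ∷_) (sublists xs)) (sublists xs) ⟩
  sum (map g (map (x ∷_) (sublists xs))) + sum (map g (sublists xs))
    ≡⟨ cong₂ _+_ (trans (sum-map-∘ g (x ∷_) (sublists xs)) (sum-map-zero _ (sublists xs) (λ t _ → g∷ t (here refl))))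
                 (sum-sublists-[] g xs (λ t x∈ → g∷ t (there x∈))) ⟩
  g [] ∎
  where open ≡-Reasoning

range : ℕ → ℕ → List ℕ
range a zero    = []
range a (suc m) = a ∷ range (suc a) m

map-range-suc : (f : ℕ → A) (a n : ℕ) → map (f ∘ suc) (range a n) ≡ map f (range (suc a) n)
map-range-suc f a zero    = refl
map-range-suc f a (suc n) = cong (f (suc a) ∷_) (map-range-suc f (suc a) n)

applyUpTo≡map-range : (f : ℕ → A) (n : ℕ) → applyUpTo f n ≡ map f (range 0 n)
applyUpTo≡map-range f zero    = refl
applyUpTo≡map-range f (suc n) = cong (f 0 ∷_) (trans (applyUpTo≡map-range (f ∘ suc) n) (map-range-suc f 0 n))

upTo≡range : (n : ℕ) → upTo n ≡ range 0 n
upTo≡range n = trans (applyUpTo≡map-range id n) (map-id (range 0 n))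

∈-range⁻ : {i : ℕ} (a m : ℕ) → i ∈ range a m → a ≤ i × i < a + m
∈-range⁻ a (suc m) (here refl) = ≤-refl , ≤-trans (s≤s (m≤m+n a m)) (≤-reflexive (sym (+-suc a m)))
∈-range⁻ a (suc m) (there i∈) with ∈-range⁻ (suc a) m i∈
... | a<i , i<end = <⇒≤ a<i , ≤-trans i<end (≤-reflexive (sym (+-suc a m)))

range-++ : (a m n : ℕ) → range a (m + n) ≡ range a m ++ range (a + m) n
range-++ a zero    n = cong (λ b → range b n) (sym (+-identityʳ a))
range-++ a (suc m) n = cong (a ∷_) (trans (range-++ (suc a) m n) (cong (λ b → range (suc a) m ++ range b n) (sym (+-suc a m))))

sum-indicator-∉ : (l : ℕ) (e : ℕ → ℕ) (xs : List ℕ) → (∀ {j} → j ∈ xs → j ≢ l) →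
  sum (map (λ j → if j ≡ᵇ l then e j else 0) xs) ≡ 0
sum-indicator-∉ l e xs ∉ = sum-map-zero _ xs (λ j j∈ → cong (λ b → if b then e j else 0) (≡ᵇ-false (∉ j∈)))

sum-indicator-range : (l : ℕ) (e : ℕ → ℕ) (a m : ℕ) → a ≤ l → l < a + m →
  sum (map (λ j → if j ≡ᵇ l then e j else 0) (range a m)) ≡ e l
sum-indicator-range l e a zero    a≤l l<a = ⊥-elim (<⇒≱ l<a (≤-trans (≤-reflexive (+-identityʳ a)) a≤l))
sum-indicator-range l e a (suc m) a≤l l<end with m≤n⇒m<n∨m≡n a≤l
... | inj₂ refl rewrite ≡ᵇ-true {a} refl =
  trans (cong (e a +_) (sum-indicator-∉ a e (range (suc a) m) (λ j∈ → ≢-sym (<⇒≢ (proj₁ (∈-range⁻ (suc a) m j∈))))))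
        (+-identityʳ (e a))
... | inj₁ a<l rewrite ≡ᵇ-false (<⇒≢ a<l) = sum-indicator-range l e (suc a) m a<l (≤-trans l<end (≤-reflexive (+-suc a m)))

yAt-0 : (z : List ℕ) → yAt z 0 ≡ 0
yAt-0 []      = refl
yAt-0 (_ ∷ _) = refl

yAt-beyond : (z : List ℕ) {j : ℕ} → length z < j → yAt z j ≡ 0
yAt-beyond []      _                 = refl
yAt-beyond (x ∷ z) {suc (suc j)} (s≤s lt) = yAt-beyond z lt

map-yAt : (z : List ℕ) → map (yAt z) (range 1 (length z)) ≡ z
map-yAt []      = refl
map-yAt (x ∷ z) = cong (x ∷_) (trans (sym (map-range-suc (yAt (x ∷ z)) 1 (length z)))
                                      (trans (map-cong-local (All.tabulate shift)) (map-yAt z)))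
  where
  shift : ∀ {j} → j ∈ range 1 (length z) → yAt (x ∷ z) (suc j) ≡ yAt z j
  shift {suc j} _  = refl
  shift {zero}  j∈ = ⊥-elim (1+n≰n (proj₁ (∈-range⁻ 1 (length z) j∈)))

iter-suc : (n : ℕ) (S R : List Vtx) → iter (suc n) S R ≡ grow S (iter n S R)
iter-suc zero    S R = refl
iter-suc (suc n) S R = iter-suc n S (grow S R)

∈-iter-mono : {w : Vtx} (n m : ℕ) (S R : List Vtx) → n ≤ m → w ∈ iter n S R → w ∈ iter m S R
∈-iter-mono zero    zero    S R z≤n      w∈ = w∈
∈-iter-mono zero    (suc m) S R z≤n      w∈ = ∈-iter-mono zero m S (grow S R) z≤n (∈-++⁺ˡ w∈)
∈-iter-mono (suc n) (suc m) S R (s≤s le) w∈ = ∈-iter-mono n m S (grow S R) le w∈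

∈-iter-step : {u w : Vtx} (n : ℕ) (S R : List Vtx) →
  u ∈ iter n S R → w ∈ S → T (adj w u) → w ∈ iter (suc n) S R
∈-iter-step {u} {w} n S R u∈ w∈S wu rewrite iter-suc n S R with elem w (iter n S R) in w∈?
... | true  = ∈-++⁺ˡ (elem⇒∈ (iter n S R) (≡true⇒T w∈?))
... | false = ∈-++⁺ʳ (iter n S R) (∈-filter⁺ (T? ∘ grows) w∈S
                (T-∧⁺ (any⁺ (adj w) (lose u∈ wu)) (Equivalence.from T-not-≡ w∈?)))
  where
  grows : Vtx → Bool
  grows v = any (adj v) (iter n S R) ∧ not (elem v (iter n S R))

iter-closed : (Q : Vtx → Set) (S R : List Vtx) → (∀ {u w} → Q u → w ∈ S → T (adj w u) → Q w) →
  (∀ {u} → u ∈ R → Q u) → ∀ n {u} → u ∈ iter n S R → Q u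
iter-closed Q S R closed base zero    u∈ = base u∈
iter-closed Q S R closed base (suc n) u∈ = iter-closed Q S (grow S R) closed grown n u∈
  where
  grown : ∀ {u} → u ∈ grow S R → Q u
  grown u∈ with ∈-++⁻ R u∈
  ... | inj₁ u∈R = base u∈R
  ... | inj₂ u∈new with ∈-filter⁻ (T? ∘ λ v → any (adj v) R ∧ not (elem v R)) u∈new
  ...   | u∈S , new with find (any⁻ _ R (proj₁ (T-∧⁻ new)))
  ...     | x , x∈R , ux = closed (base x∈R) u∈S ux

-- The shape of a subtree of a caterpillar

index : Vtx → ℕ
index (sp i)   = i
index (lf j _) = j

IsLeaf : Vtx → Set
IsLeaf (sp _)   = ⊥
IsLeaf (lf _ _) = ⊤

within : ℕ → ℕ → Vtx → Bool
within l g w = (l ≤ᵇ index w) ∧ (index w ≤ᵇ g)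

within⁻ : (l g : ℕ) (w : Vtx) → T (within l g w) → l ≤ index w × index w ≤ g
within⁻ l g w w∈ with T-∧⁻ w∈
... | l≤w , w≤g = ≤ᵇ⇒≤ l (index w) l≤w , ≤ᵇ⇒≤ (index w) g w≤g

within⁺ : (l g : ℕ) (w : Vtx) → l ≤ index w → index w ≤ g → T (within l g w)
within⁺ l g w l≤w w≤g = T-∧⁺ (≤⇒≤ᵇ l≤w) (≤⇒≤ᵇ w≤g)

run : ℕ → ℕ → List Vtx
run a zero    = []
run a (suc m) = sp a ∷ run (suc a) m

spineInterval : ℕ → ℕ → List Vtx → List Vtx
spineInterval l n t = sp l ∷ run (suc l) n ++ t

length-run : (a m : ℕ) → length (run a m) ≡ m
length-run a zero    = refl
length-run a (suc m) = cong suc (length-run (suc a) m)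

∈-run⁻ : {w : Vtx} (a m : ℕ) → w ∈ run a m → ∃[ e ] (e < m × w ≡ sp (a + e))
∈-run⁻ a (suc m) (here refl) = 0 , s≤s z≤n , cong sp (sym (+-identityʳ a))
∈-run⁻ a (suc m) (there w∈) with ∈-run⁻ (suc a) m w∈
... | e , e<m , refl = suc e , s≤s e<m , cong sp (sym (+-suc a e))

∈-run⁺ : (a m e : ℕ) → e < m → sp (a + e) ∈ run a m
∈-run⁺ a (suc m) zero    _          = here (cong sp (+-identityʳ a))
∈-run⁺ a (suc m) (suc e) (s≤s e<m) = there (subst (λ i → sp i ∈ run (suc a) m) (sym (+-suc a e)) (∈-run⁺ (suc a) m e e<m))

map-sp-range : (a m : ℕ) → map sp (range a m) ≡ run a m
map-sp-range a zero    = refl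
map-sp-range a (suc m) = cong (sp a ∷_) (map-sp-range (suc a) m)

Ascending : ℕ → List Vtx → Set
Ascending a []           = ⊤
Ascending a (sp i ∷ s)   = a ≤ i × Ascending (suc i) s
Ascending a (lf _ _ ∷ s) = ⊥

Ascending-weaken : {a b : ℕ} (s : List Vtx) → a ≤ b → Ascending b s → Ascending a s
Ascending-weaken []         a≤b _            = _
Ascending-weaken (sp i ∷ s) a≤b (b≤i , asc) = ≤-trans a≤b b≤i , asc

Ascending-index : {a : ℕ} {w : Vtx} (s : List Vtx) → Ascending a s → w ∈ s → a ≤ index w
Ascending-index (sp i ∷ s) (a≤i , _)   (here refl) = a≤i
Ascending-index (sp i ∷ s) (a≤i , asc) (there w∈s) = ≤-trans a≤i (<⇒≤ (Ascending-index s asc w∈s))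

Ascending-run : {a b : ℕ} (n : ℕ) → a ≤ b → Ascending a (run b n)
Ascending-run zero    _   = _
Ascending-run (suc n) a≤b = a≤b , Ascending-run n ≤-refl

Ascending-sublists : {a : ℕ} {s : List Vtx} (m : ℕ) → s ∈ sublists (run a m) → Ascending a s
Ascending-sublists zero    (here refl) = _
Ascending-sublists {a} (suc m) s∈ with ∈-++⁻ (map (sp a ∷_) (sublists (run (suc a) m))) s∈
... | inj₁ s∈′ with ∈-map⁻ (sp a ∷_) s∈′
...   | s′ , s′∈ , refl = ≤-refl , Ascending-sublists m s′∈
Ascending-sublists {a} (suc m) s∈ | inj₂ s∈′ = Ascending-weaken _ (n≤1+n a) (Ascending-sublists m s∈′)

isRunFrom : ℕ → List Vtx → Bool
isRunFrom a []           = true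
isRunFrom a (sp i ∷ s)   = (i ≡ᵇ suc a) ∧ isRunFrom (suc a) s
isRunFrom a (lf _ _ ∷ s) = false

runEnd : ℕ → List Vtx → ℕ
runEnd a []           = a
runEnd a (sp i ∷ s)   = if i ≡ᵇ suc a then runEnd (suc a) s else a
runEnd a (lf _ _ ∷ s) = a

sp-injective : {i j : ℕ} → sp i ≡ sp j → i ≡ j
sp-injective refl = refl

runEnd-≥ : (a : ℕ) (s : List Vtx) → a ≤ runEnd a s
runEnd-≥ a []           = ≤-refl
runEnd-≥ a (sp i ∷ s) with i ≡ᵇ suc a
... | true  = ≤-trans (n≤1+n a) (runEnd-≥ (suc a) s)
... | false = ≤-refl
runEnd-≥ a (lf _ _ ∷ s) = ≤-refl

runEnd-next-∉ : (l : ℕ) (s : List Vtx) → Ascending (suc l) s → ¬ sp (suc (runEnd l s)) ∈ sp l ∷ s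
runEnd-next-∉ l []         _           (here eq) = 1+n≢n (sp-injective eq)
runEnd-next-∉ l (sp i ∷ s) (l<i , asc) w∈ with i ≡ᵇ suc l in i≟
... | true with ≡ᵇ⇒≡ i (suc l) (≡true⇒T i≟) | w∈
...   | refl | here eq   = 1+n≰n (≤-trans (runEnd-≥ (suc l) s) (≤-trans (n≤1+n _) (≤-reflexive (sp-injective eq))))
...   | refl | there w∈′ = runEnd-next-∉ (suc l) s asc w∈′
runEnd-next-∉ l (sp i ∷ s) (l<i , asc) w∈ | false with w∈
... | here eq          = 1+n≢n (sp-injective eq)
... | there (here eq)  = subst T i≟ (≡⇒≡ᵇ i (suc l) (sym (sp-injective eq)))
... | there (there w∈s) = 1+n≰n (≤-trans (Ascending-index s asc w∈s) l<i)

isRunFrom-within : (l : ℕ) (s : List Vtx) → Ascending (suc l) s →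
  (∀ {w} → w ∈ s → T (within l (runEnd l s) w)) → T (isRunFrom l s)
isRunFrom-within l []         _           _ = _
isRunFrom-within l (sp i ∷ s) (l<i , asc) inside with i ≡ᵇ suc l in i≟
... | true with ≡ᵇ⇒≡ i (suc l) (≡true⇒T i≟)
...   | refl = isRunFrom-within (suc l) s asc λ {w} w∈s →
                 within⁺ (suc l) (runEnd (suc l) s) w (<⇒≤ (Ascending-index s asc w∈s))
                         (proj₂ (within⁻ l (runEnd (suc l) s) w (inside (there w∈s))))
isRunFrom-within l (sp i ∷ s) (l<i , asc) inside | false =
  1+n≰n (≤-trans l<i (proj₂ (within⁻ l l (sp i) (inside (here refl)))))

isRunFrom⇒run : (a : ℕ) (s : List Vtx) → T (isRunFrom a s) → s ≡ run (suc a) (length s)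
isRunFrom⇒run a []         _     = refl
isRunFrom⇒run a (sp i ∷ s) isRun with T-∧⁻ isRun
... | i≡ , isRun′ with ≡ᵇ⇒≡ i (suc a) i≡
...   | refl = cong (sp (suc a) ∷_) (isRunFrom⇒run (suc a) s isRun′)

isRunFrom-run : (a n : ℕ) → T (isRunFrom a (run (suc a) n))
isRunFrom-run a zero    = _
isRunFrom-run a (suc n) = T-∧⁺ (≡⇒≡ᵇ (suc a) (suc a) refl) (isRunFrom-run (suc a) n)

runEnd-run : (a n : ℕ) → runEnd a (run (suc a) n) ≡ a + n
runEnd-run a zero    = sym (+-identityʳ a)
runEnd-run a (suc n) rewrite ≡ᵇ-true {a} refl = trans (runEnd-run (suc a) n) (sym (+-suc a n))

run-subtree : (l n : ℕ) (t : List Vtx) → (∀ {w} → w ∈ t → IsLeaf w) →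
  T (all (within l (l + n)) t) → T (isSubtree (spineInterval l n t))
run-subtree l n t leaves t-inside = all⁻ (λ w → elem w (iter (length S) S R₀)) (All.tabulate (∈⇒elem ∘ reached))
  where
  S  = spineInterval l n t
  R₀ = sp l ∷ []

  n<∣S∣ : n < length S
  n<∣S∣ = s≤s (≤-trans (≤-reflexive (sym (length-run (suc l) n))) (length-++-≤ˡ (run (suc l) n)))

  reach : ∀ d → d ≤ n → sp (l + d) ∈ iter d S R₀
  reach zero    _   = here (cong sp (+-identityʳ l))
  reach (suc d) d<n = ∈-iter-step d S R₀ (reach d (<⇒≤ d<n))
    (there (∈-++⁺ˡ (subst (λ i → sp i ∈ run (suc l) n) (sym (+-suc l d)) (∈-run⁺ (suc l) n d d<n))))
    (Equivalence.from T-∨ (inj₂ (≡⇒≡ᵇ (l + d + 1) (l + suc d) (trans (+-comm (l + d) 1) (sym (+-suc l d))))))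

  reached : ∀ {w} → w ∈ S → w ∈ iter (length S) S R₀
  reached (here refl) = ∈-iter-mono 0 (length S) S R₀ z≤n (here refl)
  reached (there w∈) with ∈-++⁻ (run (suc l) n) w∈
  ... | inj₁ w∈run with ∈-run⁻ (suc l) n w∈run
  ...   | e , e<n , refl = ∈-iter-mono (suc e) (length S) S R₀ (≤-trans e<n (<⇒≤ n<∣S∣))
                             (subst (λ i → sp i ∈ iter (suc e) S R₀) (+-suc l e) (reach (suc e) e<n))
  reached {lf j y} (there w∈) | inj₂ w∈t = ∈-iter-mono (suc d) (length S) S R₀ (≤-trans (s≤s d≤n) n<∣S∣)
      (∈-iter-step d S R₀ (reach d d≤n) (there (∈-++⁺ʳ (run (suc l) n) w∈t)) (≡⇒≡ᵇ (l + d) j (m+[n∸m]≡n l≤j)))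
    where
    bounds = within⁻ l (l + n) (lf j y) (All.lookup (all⁺ _ t t-inside) w∈t)
    l≤j = proj₁ bounds
    d   = j ∸ l
    d≤n : d ≤ n
    d≤n = ≤-trans (∸-monoˡ-≤ l (proj₂ bounds)) (≤-reflexive (m+n∸m≡n l n))
  reached {sp j} (there w∈) | inj₂ w∈t = ⊥-elim (leaves w∈t)

module SubtreeShape (l : ℕ) (s t : List Vtx) (asc : Ascending (suc l) s) (leaves : ∀ {w} → w ∈ t → IsLeaf w) where

  S : List Vtx
  S = sp l ∷ s ++ t

  g : ℕ
  g = runEnd l s

  spine-∈ : {j : ℕ} → sp j ∈ S → sp j ∈ sp l ∷ s
  spine-∈ (here eq)  = here eq
  spine-∈ (there j∈) with ∈-++⁻ s j∈
  ... | inj₁ j∈s = there j∈s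
  ... | inj₂ j∈t = ⊥-elim (leaves j∈t)

  l≤spine : {j : ℕ} → sp j ∈ S → l ≤ j
  l≤spine j∈ with spine-∈ j∈
  ... | here refl = ≤-refl
  ... | there j∈s = <⇒≤ (Ascending-index s asc j∈s)

  within-closed : ∀ {u w} → T (within l g u) → w ∈ S → T (adj w u) → T (within l g w)
  within-closed {sp i} {sp j} u-in w∈ a with Equivalence.to T-∨ a | within⁻ l g (sp i) u-in
  ... | inj₁ j+1≡i | _ , i≤g = within⁺ l g (sp j) (l≤spine w∈)
                                  (≤-trans (m≤m+n j 1) (≤-trans (≤-reflexive (≡ᵇ⇒≡ (j + 1) i j+1≡i)) i≤g))
  ... | inj₂ i+1≡j | l≤i , i≤g with ≡ᵇ⇒≡ (i + 1) j i+1≡j | m≤n⇒m<n∨m≡n i≤g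
  ...   | refl | inj₁ i<g  = within⁺ l g (sp (i + 1)) (≤-trans l≤i (m≤m+n i 1)) (≤-trans (≤-reflexive (+-comm i 1)) i<g)
  ...   | refl | inj₂ refl = ⊥-elim (runEnd-next-∉ l s asc (spine-∈ (subst (λ k → sp k ∈ S) (+-comm g 1) w∈)))
  within-closed {sp i}   {lf j _} u-in _ a with ≡ᵇ⇒≡ i j a
  ... | refl = u-in
  within-closed {lf j _} {sp i}   u-in _ a with ≡ᵇ⇒≡ i j a
  ... | refl = u-in

  subtree-within : T (isSubtree S) → ∀ {w} → w ∈ S → T (within l g w)
  subtree-within st {w} w∈ = iter-closed (T ∘ within l g) S (sp l ∷ []) within-closed
    (λ { (here refl) → within⁺ l g (sp l) ≤-refl (runEnd-≥ l s) }) (length S) {w}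
    (elem⇒∈ _ (All.lookup (all⁺ (λ w → elem w (iter (length S) S (sp l ∷ []))) S st) w∈))

subtree-shape : (l : ℕ) (s t : List Vtx) → Ascending (suc l) s → (∀ {w} → w ∈ t → IsLeaf w) →
  isSubtree (sp l ∷ s ++ t) ≡ isRunFrom l s ∧ all (within l (runEnd l s)) t
subtree-shape l s t asc leaves = T-ext forward backward
  where
  open SubtreeShape l s t asc leaves

  forward : T (isSubtree S) → T (isRunFrom l s ∧ all (within l g) t)
  forward st = T-∧⁺ (isRunFrom-within l s asc (λ w∈s → subtree-within st (there (∈-++⁺ˡ w∈s))))
                     (all⁻ _ (All.tabulate (λ w∈t → subtree-within st (there (∈-++⁺ʳ s w∈t)))))

  backward : T (isRunFrom l s ∧ all (within l g) t) → T (isSubtree S)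
  backward h with T-∧⁻ h
  ... | isRun , t-inside = subst (λ s′ → T (isSubtree (sp l ∷ s′ ++ t))) (sym s≡run)
                             (run-subtree l (length s) t leaves (subst (λ g′ → T (all (within l g′) t)) g≡ t-inside))
    where
    s≡run = isRunFrom⇒run l s isRun
    g≡ : g ≡ l + length s
    g≡ = trans (cong (runEnd l) s≡run) (runEnd-run l (length s))

leaf-subtree : (v : Vtx) (t : List Vtx) → IsLeaf v → (∀ {w} → w ∈ t → IsLeaf w) → ¬ v ∈ t → isSubtree (v ∷ t) ≡ null t
leaf-subtree v []      _     _      _   = T⇒≡true (all⁻ (λ w → elem w (iter 1 (v ∷ []) (v ∷ []))) {v ∷ []}
  (∈⇒elem {v} (∈-iter-mono {v} 0 1 (v ∷ []) (v ∷ []) z≤n (here refl)) All.∷ All.[]))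
leaf-subtree v (w ∷ t) leafv leaves v∉t = ¬T⇒≡false λ st → v∉t (here (sym (w≡v st)))
  where
  S = v ∷ w ∷ t

  leafS : ∀ {x} → x ∈ S → IsLeaf x
  leafS (here refl) = leafv
  leafS (there x∈)  = leaves x∈

  leaves-not-adjacent : ∀ {u x} → IsLeaf u → IsLeaf x → ¬ T (adj x u)
  leaves-not-adjacent {lf _ _} {lf _ _} _ _ ()

  isolated : ∀ {u x} → u ≡ v → x ∈ S → T (adj x u) → x ≡ v
  isolated refl x∈ a = ⊥-elim (leaves-not-adjacent leafv (leafS x∈) a)

  w≡v : T (isSubtree S) → w ≡ v
  w≡v st = iter-closed (_≡ v) S (v ∷ []) isolated (λ { (here refl) → refl }) (length S)
             (elem⇒∈ _ (All.lookup (all⁺ (λ x → elem x (iter (length S) S (v ∷ []))) S st) (there (here refl))))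

count-leaf-subtrees : (P : List Vtx → Bool) (xs : List Vtx) → Unique xs → (∀ {w} → w ∈ xs → IsLeaf w) →
  count (λ t → isSubtree t ∧ P t) (sublists xs) ≡ count (λ v → P (v ∷ [])) xs
count-leaf-subtrees P []       _              _      = refl
count-leaf-subtrees P (x ∷ xs) (x∉xs AllPairs.∷ unique) leaves = begin
  count Q (map (x ∷_) (sublists xs) ++ sublists xs)
    ≡⟨ count-++ Q (map (x ∷_) (sublists xs)) (sublists xs) ⟩
  count Q (map (x ∷_) (sublists xs)) + count Q (sublists xs)
    ≡⟨ cong₂ _+_ singleton (count-leaf-subtrees P xs unique (leaves ∘ there)) ⟩
  (if P (x ∷ []) then 1 else 0) + count (λ v → P (v ∷ [])) xs
    ≡⟨ count-∷ (λ v → P (v ∷ [])) x xs ⟨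
  count (λ v → P (v ∷ [])) (x ∷ xs) ∎
  where
  open ≡-Reasoning
  Q : List Vtx → Bool
  Q t = isSubtree t ∧ P t

  isolated : ∀ t → t ∈ sublists xs → isSubtree (x ∷ t) ≡ null t
  isolated t t∈ = leaf-subtree x t (leaves (here refl)) (λ w∈ → leaves (there (∈-sublists⁻ t∈ w∈)))
                    (λ x∈t → All.lookup x∉xs (∈-sublists⁻ t∈ x∈t) refl)

  singleton : count Q (map (x ∷_) (sublists xs)) ≡ (if P (x ∷ []) then 1 else 0)
  singleton = begin
    count Q (map (x ∷_) (sublists xs))
      ≡⟨ count-map Q (x ∷_) (sublists xs) ⟩
    count (λ t → Q (x ∷ t)) (sublists xs)
      ≡⟨ count-cong _ _ (sublists xs) (λ t t∈ → cong (_∧ P (x ∷ t)) (isolated t t∈)) ⟩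
    count (λ t → null t ∧ P (x ∷ t)) (sublists xs)
      ≡⟨ count≡sum _ (sublists xs) ⟩
    sum (map (λ t → if null t ∧ P (x ∷ t) then 1 else 0) (sublists xs))
      ≡⟨ sum-sublists-[] _ xs (λ _ _ → refl) ⟩
    (if P (x ∷ []) then 1 else 0) ∎

countedByF : (Vtx → Bool) → Vtx → List Vtx → Bool
countedByF W v S = elem v S ∧ all W S

rowValue : (ℕ → ℕ) → ℕ → List Vtx → ℕ
rowValue κ a s = if isRunFrom a s then κ (runEnd a s) else 0

runValue : (ℕ → ℕ → ℕ) → List Vtx → ℕ
runValue h []           = 0
runValue h (sp l ∷ s)   = rowValue (h l) l s
runValue h (lf _ _ ∷ _) = 0

intervalSum : (ℕ → ℕ → ℕ) → ℕ → ℕ → ℕ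
intervalSum h a zero    = 0
intervalSum h a (suc m) = sum (map (h a) (range a (suc m))) + intervalSum h (suc a) m

sum-rowValue : (κ : ℕ → ℕ) (a m : ℕ) → sum (map (rowValue κ a) (sublists (run (suc a) m))) ≡ sum (map κ (range a (suc m)))
sum-rowValue κ a zero    = refl
sum-rowValue κ a (suc m) = begin
  sum (map (rowValue κ a) (map (sp (suc a) ∷_) SL ++ SL))
    ≡⟨ sum-map-++ (rowValue κ a) (map (sp (suc a) ∷_) SL) SL ⟩
  sum (map (rowValue κ a) (map (sp (suc a) ∷_) SL)) + sum (map (rowValue κ a) SL)
    ≡⟨ cong₂ _+_ (trans (sum-map-∘ (rowValue κ a) (sp (suc a) ∷_) SL)
                        (trans (sum-map-cong _ (rowValue κ (suc a)) SL (λ s _ → extend s)) (sum-rowValue κ (suc a) m)))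
                 (sum-sublists-[] (rowValue κ a) (run (suc (suc a)) m) too-far) ⟩
  sum (map κ (range (suc a) (suc m))) + κ a
    ≡⟨ +-comm _ (κ a) ⟩
  sum (map κ (range a (suc (suc m)))) ∎
  where
  open ≡-Reasoning
  SL = sublists (run (suc (suc a)) m)

  extend : (s : List Vtx) → rowValue κ a (sp (suc a) ∷ s) ≡ rowValue κ (suc a) s
  extend s rewrite ≡ᵇ-true {a} refl = refl

  too-far : ∀ {x} t → x ∈ run (suc (suc a)) m → rowValue κ a (x ∷ t) ≡ 0
  too-far t x∈ with ∈-run⁻ (suc (suc a)) m x∈
  ... | e , _ , refl rewrite ≡ᵇ-false {suc (suc a) + e} {suc a} (λ eq → 1+n≰n (≤-trans (m≤m+n (suc (suc a)) e) (≤-reflexive eq)))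
                     = refl

sum-runValue : (h : ℕ → ℕ → ℕ) (a m : ℕ) → sum (map (runValue h) (sublists (run a m))) ≡ intervalSum h a m
sum-runValue h a zero    = refl
sum-runValue h a (suc m) = begin
  sum (map (runValue h) (map (sp a ∷_) SL ++ SL))
    ≡⟨ sum-map-++ (runValue h) (map (sp a ∷_) SL) SL ⟩
  sum (map (runValue h) (map (sp a ∷_) SL)) + sum (map (runValue h) SL)
    ≡⟨ cong₂ _+_ (trans (sum-map-∘ (runValue h) (sp a ∷_) SL) (sum-rowValue (h a) a m)) (sum-runValue h (suc a) m) ⟩
  intervalSum h a (suc m) ∎
  where
  open ≡-Reasoning
  SL = sublists (run (suc a) m)

intervalSum-cong : (h h′ : ℕ → ℕ → ℕ) (a m : ℕ) → (∀ l g → h l g ≡ h′ l g) →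
  intervalSum h a m ≡ intervalSum h′ a m
intervalSum-cong h h′ a zero    eq = refl
intervalSum-cong h h′ a (suc m) eq =
  cong₂ _+_ (cong sum (map-cong (eq a) (range a (suc m)))) (intervalSum-cong h h′ (suc a) m eq)

intervalSum-zero : (h : ℕ → ℕ → ℕ) (a m : ℕ) → (∀ {l g} → a ≤ l → l ≤ g → h l g ≡ 0) → intervalSum h a m ≡ 0
intervalSum-zero h a zero    vanish = refl
intervalSum-zero h a (suc m) vanish =
  cong₂ _+_ (sum-map-zero (h a) (range a (suc m)) (λ g g∈ → vanish ≤-refl (proj₁ (∈-range⁻ a (suc m) g∈))))
            (intervalSum-zero h (suc a) m (λ a<l → vanish (<⇒≤ a<l)))

intervalSum-row : (h : ℕ → ℕ → ℕ) (m a M : ℕ) → a ≤ m → m < a + M →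
  intervalSum (λ l g → if l ≡ᵇ m then h l g else 0) a M ≡ sum (map (h m) (range m (a + M ∸ m)))
intervalSum-row h m a zero    a≤m m<a = ⊥-elim (<⇒≱ m<a (≤-trans (≤-reflexive (+-identityʳ a)) a≤m))
intervalSum-row h m a (suc M) a≤m m<end with m≤n⇒m<n∨m≡n a≤m
... | inj₂ refl rewrite ≡ᵇ-true {a} refl | m+n∸m≡n a (suc M) =
  trans (cong (sum (map (h a) (range a (suc M))) +_)
              (intervalSum-zero _ (suc a) M (λ {l} {g} a<l _ →
                 cong (λ b → if b then h l g else 0) (≡ᵇ-false (≢-sym (<⇒≢ a<l))))))
        (+-identityʳ _)
... | inj₁ a<m rewrite ≡ᵇ-false (<⇒≢ a<m) =
  trans (cong (_+ intervalSum _ (suc a) M) (sum-map-zero (λ _ → 0) (range a (suc M)) (λ _ _ → refl)))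
        (trans (intervalSum-row h m (suc a) M a<m (≤-trans m<end (≤-reflexive (+-suc a M))))
               (cong (λ e → sum (map (h m) (range m (e ∸ m)))) (sym (+-suc a M))))

intervalSum-column : (h : ℕ → ℕ → ℕ) (m a M : ℕ) → a ≤ suc m → m < a + M →
  intervalSum (λ l g → if g ≡ᵇ m then h l g else 0) a M ≡ sum (map (λ l → h l m) (range a (suc m ∸ a)))
intervalSum-column h m a zero    a≤m+1 m<a rewrite m≤n⇒m∸n≡0 (≤-trans m<a (≤-reflexive (+-identityʳ a))) = refl
intervalSum-column h m a (suc M) a≤m+1 m<end with m≤n⇒m<n∨m≡n a≤m+1
... | inj₂ refl rewrite n∸n≡0 (suc m) = intervalSum-zero _ (suc m) (suc M)
  (λ {l} {g} m<l l≤g → cong (λ b → if b then h l g else 0)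
                          (≡ᵇ-false (λ g≡m → 1+n≰n (≤-trans m<l (≤-trans l≤g (≤-reflexive g≡m))))))
... | inj₁ (s≤s a≤m) rewrite +-∸-assoc 1 a≤m =
  cong₂ _+_ (sum-indicator-range m (h a) a (suc M) a≤m m<end)
            (intervalSum-column h m (suc a) M (s≤s a≤m) (≤-trans m<end (≤-reflexive (+-suc a M))))

V-index : (j : ℕ) (w : Vtx) → V j w ≡ (index w ≡ᵇ j)
V-index j (sp _)   = refl
V-index j (lf _ _) = refl

V≤-index : (m : ℕ) (w : Vtx) → V≤ m w ≡ (index w ≤ᵇ m)
V≤-index m (sp _)   = refl
V≤-index m (lf _ _) = refl

V≥-index : (m : ℕ) (w : Vtx) → V≥ m w ≡ (m ≤ᵇ index w)
V≥-index m (sp _)   = refl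
V≥-index m (lf _ _) = refl

module SpineInterval (l n : ℕ) (t : List Vtx) (leaves : ∀ {w} → w ∈ t → IsLeaf w) (t-inside : T (all (within l (l + n)) t)) where

  S : List Vtx
  S = spineInterval l n t

  member-bounds : ∀ {w} → w ∈ S → l ≤ index w × index w ≤ l + n
  member-bounds (here refl) = ≤-refl , m≤m+n l n
  member-bounds (there w∈) with ∈-++⁻ (run (suc l) n) w∈
  ... | inj₁ w∈run with ∈-run⁻ (suc l) n w∈run
  ...   | e , e<n , refl = ≤-trans (m≤m+n l e) (n≤1+n _) , ≤-trans (≤-reflexive (sym (+-suc l e))) (+-monoʳ-≤ l e<n)
  member-bounds {w} (there w∈) | inj₂ w∈t = within⁻ l (l + n) w (All.lookup (all⁺ (within l (l + n)) t t-inside) w∈t)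

  spine-∈ : ∀ {j} → l ≤ j → j ≤ l + n → sp j ∈ S
  spine-∈ l≤j j≤end with m≤n⇒m<n∨m≡n l≤j
  ... | inj₂ refl = here refl
  ... | inj₁ l<j with m≤n⇒∃[o]m+o≡n l<j
  ...   | e , refl = there (∈-++⁺ˡ (∈-run⁺ (suc l) n e (+-cancelˡ-≤ l (suc e) n (≤-trans (≤-reflexive (+-suc l e)) j≤end))))

  contains-spine : ∀ j → T (elem (sp j) S) ⇔ (l ≤ j × j ≤ l + n)
  contains-spine j = mk⇔ (member-bounds ∘ elem⇒∈ {sp j} S) (λ (l≤j , j≤end) → ∈⇒elem {sp j} (spine-∈ l≤j j≤end))

  inside-convex : (W : Vtx → Bool) (R : ℕ → Bool) → (∀ w → W w ≡ R (index w)) →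
    (∀ {a b i} → T (R a) → T (R b) → a ≤ i → i ≤ b → T (R i)) → T (all W S) ⇔ (T (R l) × T (R (l + n)))
  inside-convex W R W≡R convex = mk⇔
    (λ all-in → let lookup = All.lookup (all⁺ W S all-in) in
       subst T (W≡R (sp l)) (lookup (here refl)) , subst T (W≡R (sp (l + n))) (lookup (spine-∈ (m≤m+n l n) ≤-refl)))
    (λ (Rl , Rend) → all⁻ W (All.tabulate (λ {w} w∈ →
       subst T (sym (W≡R w)) (convex Rl Rend (proj₁ (member-bounds w∈)) (proj₂ (member-bounds w∈))))))

  region : (W : Vtx → Bool) (R : ℕ → Bool) (j : ℕ) (c : Bool) → (∀ w → W w ≡ R (index w)) →
    (∀ {a b i} → T (R a) → T (R b) → a ≤ i → i ≤ b → T (R i)) →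
    (T c ⇔ ((l ≤ j × j ≤ l + n) × (T (R l) × T (R (l + n))))) → countedByF W (sp j) S ≡ c
  region W R j c W≡R convex c⇔ = T-ext
    (λ h → let (has-j , all-in) = T-∧⁻ {elem (sp j) S} {all W S} h in
       Equivalence.from c⇔ (Equivalence.to (contains-spine j) has-j , Equivalence.to ends all-in))
    (λ h → let (has-j , all-in) = Equivalence.to c⇔ h in
       T-∧⁺ (Equivalence.from (contains-spine j) has-j) (Equivalence.from ends all-in))
    where
    ends = inside-convex W R W≡R convex

region-V : (j l n : ℕ) (t : List Vtx) (leaves : ∀ {w} → w ∈ t → IsLeaf w) (t-inside : T (all (within l (l + n)) t)) →
  countedByF (V j) (sp j) (spineInterval l n t) ≡ (l ≡ᵇ j) ∧ (l + n ≡ᵇ j)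
region-V j l n t leaves t-inside =
  SpineInterval.region l n t leaves t-inside (V j) (_≡ᵇ j) j _ (V-index j) convex (mk⇔ from to)
  where
  convex : ∀ {a b i} → T (a ≡ᵇ j) → T (b ≡ᵇ j) → a ≤ i → i ≤ b → T (i ≡ᵇ j)
  convex {a} {b} {i} a≡j b≡j a≤i i≤b with ≡ᵇ⇒≡ a j a≡j | ≡ᵇ⇒≡ b j b≡j
  ... | refl | refl = ≡⇒≡ᵇ i a (≤-antisym i≤b a≤i)

  to : (l ≤ j × j ≤ l + n) × (T (l ≡ᵇ j) × T (l + n ≡ᵇ j)) → T ((l ≡ᵇ j) ∧ (l + n ≡ᵇ j))
  to (_ , l≡j , end≡j) = T-∧⁺ l≡j end≡j

  from : T ((l ≡ᵇ j) ∧ (l + n ≡ᵇ j)) → (l ≤ j × j ≤ l + n) × (T (l ≡ᵇ j) × T (l + n ≡ᵇ j))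
  from h with T-∧⁻ {l ≡ᵇ j} {l + n ≡ᵇ j} h
  ... | l≡j , end≡j with ≡ᵇ⇒≡ l j l≡j
  ...   | refl = (≤-refl , m≤m+n l n) , l≡j , end≡j

region-V≥ : (m l n : ℕ) (t : List Vtx) (leaves : ∀ {w} → w ∈ t → IsLeaf w) (t-inside : T (all (within l (l + n)) t)) →
  countedByF (V≥ m) (sp m) (spineInterval l n t) ≡ (l ≡ᵇ m)
region-V≥ m l n t leaves t-inside =
  SpineInterval.region l n t leaves t-inside (V≥ m) (m ≤ᵇ_) m _ (V≥-index m) convex (mk⇔ from to)
  where
  convex : ∀ {a b i} → T (m ≤ᵇ a) → T (m ≤ᵇ b) → a ≤ i → i ≤ b → T (m ≤ᵇ i)
  convex {a} m≤a _ a≤i _ = ≤⇒≤ᵇ (≤-trans (≤ᵇ⇒≤ m a m≤a) a≤i)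

  to : (l ≤ m × m ≤ l + n) × (T (m ≤ᵇ l) × T (m ≤ᵇ l + n)) → T (l ≡ᵇ m)
  to ((l≤m , _) , m≤l , _) = ≡⇒≡ᵇ l m (≤-antisym l≤m (≤ᵇ⇒≤ m l m≤l))

  from : T (l ≡ᵇ m) → (l ≤ m × m ≤ l + n) × (T (m ≤ᵇ l) × T (m ≤ᵇ l + n))
  from l≡m with ≡ᵇ⇒≡ l m l≡m
  ... | refl = (≤-refl , m≤m+n l n) , ≤⇒≤ᵇ (≤-refl {l}) , ≤⇒≤ᵇ (m≤m+n l n)

region-V≤ : (m l n : ℕ) (t : List Vtx) (leaves : ∀ {w} → w ∈ t → IsLeaf w) (t-inside : T (all (within l (l + n)) t)) →
  countedByF (V≤ m) (sp m) (spineInterval l n t) ≡ (l + n ≡ᵇ m)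
region-V≤ m l n t leaves t-inside =
  SpineInterval.region l n t leaves t-inside (V≤ m) (_≤ᵇ m) m _ (V≤-index m) convex (mk⇔ from to)
  where
  convex : ∀ {a b i} → T (a ≤ᵇ m) → T (b ≤ᵇ m) → a ≤ i → i ≤ b → T (i ≤ᵇ m)
  convex {b = b} _ b≤m _ i≤b = ≤⇒≤ᵇ (≤-trans i≤b (≤ᵇ⇒≤ b m b≤m))

  to : (l ≤ m × m ≤ l + n) × (T (l ≤ᵇ m) × T (l + n ≤ᵇ m)) → T (l + n ≡ᵇ m)
  to ((_ , m≤end) , _ , end≤m) = ≡⇒≡ᵇ (l + n) m (≤-antisym (≤ᵇ⇒≤ (l + n) m end≤m) m≤end)

  from : T (l + n ≡ᵇ m) → (l ≤ m × m ≤ l + n) × (T (l ≤ᵇ m) × T (l + n ≤ᵇ m))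
  from end≡m with ≡ᵇ⇒≡ (l + n) m end≡m
  ... | refl = (m≤m+n l n , ≤-refl) , ≤⇒≤ᵇ (m≤m+n l n) , ≤⇒≤ᵇ (≤-refl {l + n})

-- Sums of products of the prefixes, suffixes and segments of a list

prefixProducts : List ℕ → ℕ
prefixProducts []       = 0
prefixProducts (x ∷ xs) = x + x * prefixProducts xs

suffixProducts : List ℕ → ℕ
suffixProducts []       = 0
suffixProducts (x ∷ xs) = product (x ∷ xs) + suffixProducts xs

segmentProducts : List ℕ → ℕ
segmentProducts []       = 0
segmentProducts (x ∷ xs) = prefixProducts (x ∷ xs) + segmentProducts xs

prefixProducts-++ : (xs ys : List ℕ) → prefixProducts (xs ++ ys) ≡ prefixProducts xs + product xs * prefixProducts ys
prefixProducts-++ []       ys = sym (+-identityʳ _)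
prefixProducts-++ (x ∷ xs) ys rewrite prefixProducts-++ xs ys = lemma x (prefixProducts xs) (product xs) (prefixProducts ys)
  where
  lemma : ∀ x a b c → x + x * (a + b * c) ≡ x + x * a + x * b * c
  lemma = solve-∀

suffixProducts-++ : (xs ys : List ℕ) → suffixProducts (xs ++ ys) ≡ suffixProducts xs * product ys + suffixProducts ys
suffixProducts-++ []       ys = refl
suffixProducts-++ (x ∷ xs) ys rewrite suffixProducts-++ xs ys | product-++ xs ys =
  lemma x (product xs) (product ys) (suffixProducts xs) (suffixProducts ys)
  where
  lemma : ∀ x a b s t → x * (a * b) + (s * b + t) ≡ (x * a + s) * b + t
  lemma = solve-∀

segmentProducts-++ : (xs ys : List ℕ) →
  segmentProducts (xs ++ ys) ≡ segmentProducts xs + segmentProducts ys + suffixProducts xs * prefixProducts ys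
segmentProducts-++ []       ys = sym (+-identityʳ _)
segmentProducts-++ (x ∷ xs) ys rewrite segmentProducts-++ xs ys | prefixProducts-++ xs ys =
  lemma x (prefixProducts xs) (product xs) (prefixProducts ys) (segmentProducts xs) (segmentProducts ys) (suffixProducts xs)
  where
  lemma : ∀ x a b c f g s → x + x * (a + b * c) + (f + g + s * c) ≡ x + x * a + f + g + (x * b + s) * c
  lemma = solve-∀

product-reverse : (xs : List ℕ) → product (reverse xs) ≡ product xs
product-reverse xs = product-↭ (↭-reverse xs)

prefixProducts-reverse : (xs : List ℕ) → prefixProducts (reverse xs) ≡ suffixProducts xs
prefixProducts-reverse []       = refl
prefixProducts-reverse (x ∷ xs) = begin
  prefixProducts (reverse (x ∷ xs))
    ≡⟨ cong prefixProducts (unfold-reverse x xs) ⟩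
  prefixProducts (reverse xs ++ x ∷ [])
    ≡⟨ prefixProducts-++ (reverse xs) (x ∷ []) ⟩
  prefixProducts (reverse xs) + product (reverse xs) * prefixProducts (x ∷ [])
    ≡⟨ cong₂ (λ a b → a + b * (x + x * 0)) (prefixProducts-reverse xs) (product-reverse xs) ⟩
  suffixProducts xs + product xs * (x + x * 0)
    ≡⟨ lemma x (suffixProducts xs) (product xs) ⟩
  x * product xs + suffixProducts xs ∎
  where
  open ≡-Reasoning
  lemma : ∀ x s q → s + q * (x + x * 0) ≡ x * q + s
  lemma = solve-∀

suffixProducts-reverse : (xs : List ℕ) → suffixProducts (reverse xs) ≡ prefixProducts xs
suffixProducts-reverse []       = refl
suffixProducts-reverse (x ∷ xs) = begin
  suffixProducts (reverse (x ∷ xs))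
    ≡⟨ cong suffixProducts (unfold-reverse x xs) ⟩
  suffixProducts (reverse xs ++ x ∷ [])
    ≡⟨ suffixProducts-++ (reverse xs) (x ∷ []) ⟩
  suffixProducts (reverse xs) * (x * 1) + (x * 1 + 0)
    ≡⟨ cong (λ a → a * (x * 1) + (x * 1 + 0)) (suffixProducts-reverse xs) ⟩
  prefixProducts xs * (x * 1) + (x * 1 + 0)
    ≡⟨ lemma x (prefixProducts xs) ⟩
  x + x * prefixProducts xs ∎
  where
  open ≡-Reasoning
  lemma : ∀ x a → a * (x * 1) + (x * 1 + 0) ≡ x + x * a
  lemma = solve-∀

segmentProducts-reverse : (xs : List ℕ) → segmentProducts (reverse xs) ≡ segmentProducts xs
segmentProducts-reverse []       = refl
segmentProducts-reverse (x ∷ xs) = begin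
  segmentProducts (reverse (x ∷ xs))
    ≡⟨ cong segmentProducts (unfold-reverse x xs) ⟩
  segmentProducts (reverse xs ++ x ∷ [])
    ≡⟨ segmentProducts-++ (reverse xs) (x ∷ []) ⟩
  segmentProducts (reverse xs) + (x + x * 0 + 0) + suffixProducts (reverse xs) * (x + x * 0)
    ≡⟨ cong₂ (λ a b → a + (x + x * 0 + 0) + b * (x + x * 0)) (segmentProducts-reverse xs) (suffixProducts-reverse xs) ⟩
  segmentProducts xs + (x + x * 0 + 0) + prefixProducts xs * (x + x * 0)
    ≡⟨ lemma x (segmentProducts xs) (prefixProducts xs) ⟩
  x + x * prefixProducts xs + segmentProducts xs ∎
  where
  open ≡-Reasoning
  lemma : ∀ x f a → f + (x + x * 0 + 0) + a * (x + x * 0) ≡ x + x * a + f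
  lemma = solve-∀

-- the difference of the two sides is (P − S)(L − R)
exchange-< : (c₁ c₂ L R P S Q : ℕ) → R < L → S < P →
  c₁ + (c₂ + P * R) + L * (S + Q * R) < c₁ + (c₂ + S * R) + L * (P + Q * R)
exchange-< c₁ c₂ L R P S Q R<L S<P with m≤n⇒∃[o]m+o≡n R<L | m≤n⇒∃[o]m+o≡n S<P
... | u , refl | v , refl = subst (c₁ + (c₂ + (suc S + v) * R) + (suc R + u) * (S + Q * R) <_)
                                  (sym (lemma c₁ c₂ R S Q u v)) (m<m+n _ (s≤s z≤n))
  where
  lemma : ∀ c₁ c₂ R S Q u v → c₁ + (c₂ + S * R) + (suc R + u) * ((suc S + v) + Q * R)
        ≡ c₁ + (c₂ + (suc S + v) * R) + (suc R + u) * (S + Q * R) + suc (u + v + u * v)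
  lemma = solve-∀

reverse-middle-< : (X M Z : List ℕ) → suffixProducts M < prefixProducts M → prefixProducts Z < suffixProducts X →
  segmentProducts (X ++ reverse M ++ Z) < segmentProducts (X ++ M ++ Z)
reverse-middle-< X M Z M-front Z<X = begin-strict
  segmentProducts (X ++ reverse M ++ Z)
    ≡⟨ expand (reverse M) ⟩
  c₁ + (segmentProducts (reverse M) + segmentProducts Z + suffixProducts (reverse M) * R)
     + L * (prefixProducts (reverse M) + product (reverse M) * R)
    ≡⟨ cong₂ (λ a b → c₁ + (a + segmentProducts Z + b * R) + L * (prefixProducts (reverse M) + product (reverse M) * R))
             (segmentProducts-reverse M) (suffixProducts-reverse M) ⟩
  c₁ + (c₂ + prefixProducts M * R) + L * (prefixProducts (reverse M) + product (reverse M) * R)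
    ≡⟨ cong₂ (λ a b → c₁ + (c₂ + prefixProducts M * R) + L * (a + b * R)) (prefixProducts-reverse M) (product-reverse M) ⟩
  c₁ + (c₂ + prefixProducts M * R) + L * (suffixProducts M + product M * R)
    <⟨ exchange-< c₁ c₂ L R (prefixProducts M) (suffixProducts M) (product M) Z<X M-front ⟩
  c₁ + (c₂ + suffixProducts M * R) + L * (prefixProducts M + product M * R)
    ≡⟨ expand M ⟨
  segmentProducts (X ++ M ++ Z) ∎
  where
  open ≤-Reasoning
  c₁ = segmentProducts X
  c₂ = segmentProducts M + segmentProducts Z
  L = suffixProducts X
  R = prefixProducts Z

  expand : (N : List ℕ) → segmentProducts (X ++ N ++ Z) ≡
    c₁ + (segmentProducts N + segmentProducts Z + suffixProducts N * R) + L * (prefixProducts N + product N * R)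
  expand N = trans (segmentProducts-++ X (N ++ Z))
                   (cong₂ (λ a b → c₁ + a + L * b) (segmentProducts-++ N Z) (prefixProducts-++ N Z))

prefixProducts-bracket : (x z : ℕ) (N : List ℕ) →
  prefixProducts (x ∷ N ++ z ∷ []) ≡ x * product N * z + (x * prefixProducts N + x)
prefixProducts-bracket x z N = trans (cong (λ a → x + x * a) (prefixProducts-++ N (z ∷ []))) (lemma x (prefixProducts N) (product N) z)
  where
  lemma : ∀ x a b z → x + x * (a + b * (z + z * 0)) ≡ x * b * z + (x * a + x)
  lemma = solve-∀

suffixProducts-bracket : (x z : ℕ) (N : List ℕ) →
  suffixProducts (x ∷ N ++ z ∷ []) ≡ x * product N * z + (suffixProducts N * z + z)
suffixProducts-bracket x z N = trans (cong₂ (λ a b → x * a + b) (product-++ N (z ∷ [])) (suffixProducts-++ N (z ∷ [])))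
                                     (lemma x (product N) (suffixProducts N) z)
  where
  lemma : ∀ x b s z → x * (b * (z * 1)) + (s * (z * 1) + (z * 1 + 0)) ≡ x * b * z + (s * z + z)
  lemma = solve-∀

bracket-lower : (x z : ℕ) (N : List ℕ) → z ≤ x → suffixProducts N ≤ prefixProducts N →
  suffixProducts N * z ≤ x * prefixProducts N
bracket-lower x z N z≤x N-front = ≤-trans (*-monoʳ-≤ (suffixProducts N) z≤x)
                                          (≤-trans (*-monoˡ-≤ x N-front) (≤-reflexive (*-comm (prefixProducts N) x)))

suffix≤prefix-bracket : (x z : ℕ) (N : List ℕ) → z ≤ x → suffixProducts N ≤ prefixProducts N →
  suffixProducts (x ∷ N ++ z ∷ []) ≤ prefixProducts (x ∷ N ++ z ∷ [])
suffix≤prefix-bracket x z N z≤x N-front = subst₂ _≤_ (sym (suffixProducts-bracket x z N)) (sym (prefixProducts-bracket x z N))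
  (+-monoʳ-≤ (x * product N * z) (+-mono-≤ (bracket-lower x z N z≤x N-front) z≤x))

suffix<prefix-bracket : (x z : ℕ) (N : List ℕ) → z ≤ x → suffixProducts N ≤ prefixProducts N → 1 ≤ x →
  z < x ⊎ suffixProducts N < prefixProducts N → suffixProducts (x ∷ N ++ z ∷ []) < prefixProducts (x ∷ N ++ z ∷ [])
suffix<prefix-bracket x z N z≤x N-front 1≤x strict =
  subst₂ _<_ (sym (suffixProducts-bracket x z N)) (sym (prefixProducts-bracket x z N)) (+-monoʳ-< (x * product N * z) (inner strict))
  where
  inner : z < x ⊎ suffixProducts N < prefixProducts N → suffixProducts N * z + z < x * prefixProducts N + x
  inner (inj₁ z<x)     = +-mono-≤-< (bracket-lower x z N z≤x N-front) z<x
  inner (inj₂ N-front<) = +-mono-<-≤ (≤-<-trans (*-monoʳ-≤ (suffixProducts N) z≤x)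
                                       (<-≤-trans (*-monoˡ-< x {{>-nonZero 1≤x}} N-front<)
                                                  (≤-reflexive (*-comm (prefixProducts N) x)))) z≤x

-- The subtree counts of a caterpillar

module Caterpillar (y : List ℕ) where

  k : ℕ
  k = length y

  block : ℕ → List Vtx
  block i = map (lf (suc i)) (upTo (yAt y (suc i)))

  leaves : List Vtx
  leaves = concatMap block (upTo k)

  spine≡run : map sp (upTo (k + 2)) ≡ run 0 (k + 2)
  spine≡run = trans (cong (map sp) (upTo≡range (k + 2))) (map-sp-range 0 (k + 2))

  ∈-block⁻ : ∀ {w} i → w ∈ block i → ∃[ t ] (w ≡ lf (suc i) t)
  ∈-block⁻ i w∈ with ∈-map⁻ (lf (suc i)) w∈
  ... | t , _ , eq = t , eq

  leaves-are-leaves : ∀ {w} → w ∈ leaves → IsLeaf w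
  leaves-are-leaves w∈ with find (∈-concatMap⁻ block {upTo k} w∈)
  ... | i , _ , w∈block with ∈-block⁻ i w∈block
  ...   | t , refl = _

  leaves-unique : Unique leaves
  leaves-unique = Unique.concat⁺ (All.map⁺ (All.tabulate (λ _ → Unique.map⁺ lf-injectiveʳ (Unique.upTo⁺ _))))
                                 (AllPairs.map⁺ (AllPairs.map disjoint (Unique.upTo⁺ k)))
    where
    lf-injectiveʳ : ∀ {i s t} → lf i s ≡ lf i t → s ≡ t
    lf-injectiveʳ refl = refl

    disjoint : ∀ {i j} → i ≢ j → Disjoint (block i) (block j)
    disjoint {i} {j} i≢j (w∈i , w∈j) with ∈-block⁻ i w∈i | ∈-block⁻ j w∈j
    ... | _ , refl | _ , refl = i≢j refl

  leafCount : ℕ → ℕ → ℕ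
  leafCount l g = count (within l g) leaves

  -- the number of subtrees whose spine vertices are exactly v_l, …, v_g
  subtreesOn : ℕ → ℕ → ℕ
  subtreesOn l g = 2 ^ leafCount l g

  module CountSubtrees (P : List Vtx → Bool) (c : ℕ → ℕ → Bool)
    (P≡c : ∀ l n t → (∀ {w} → w ∈ t → IsLeaf w) → T (all (within l (l + n)) t) →
           P (spineInterval l n t) ≡ c l (l + n)) where

    Q : List Vtx → Bool
    Q S = isSubtree S ∧ P S

    h : ℕ → ℕ → ℕ
    h l g = if c l g then subtreesOn l g else 0

    L : ℕ
    L = count (λ v → P (v ∷ [])) leaves

    leaf-sets : ∀ {t} → t ∈ sublists leaves → ∀ {w} → w ∈ t → IsLeaf w
    leaf-sets t∈ w∈ = leaves-are-leaves (∈-sublists⁻ t∈ w∈)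

    count-extensions-of-interval : (l n : ℕ) → count (λ t → Q (spineInterval l n t)) (sublists leaves) ≡ h l (l + n)
    count-extensions-of-interval l n = trans (count-cong _ (λ t → all (within l (l + n)) t ∧ c l (l + n)) (sublists leaves) pointwise)
                                             (count-all-∧-sublists (within l (l + n)) (c l (l + n)) leaves)
      where
      pointwise : ∀ t → t ∈ sublists leaves → Q (spineInterval l n t) ≡ all (within l (l + n)) t ∧ c l (l + n)
      pointwise t t∈ rewrite subtree-shape l (run (suc l) n) t (Ascending-run n ≤-refl) (leaf-sets t∈)
                           | T⇒≡true (isRunFrom-run l n) | runEnd-run l n
                    with all (within l (l + n)) t in inside
      ... | true  = P≡c l n t (leaf-sets t∈) (≡true⇒T inside)
      ... | false = refl

    count-extensions : (s : List Vtx) → Ascending 0 s →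
      count (λ t → Q (s ++ t)) (sublists leaves) ≡ (if null s then L else 0) + runValue h s
    count-extensions []         _         = trans (count-leaf-subtrees P leaves leaves-unique leaves-are-leaves) (sym (+-identityʳ L))
    count-extensions (sp l ∷ s) (_ , asc) with isRunFrom l s in isRun
    ... | false = count-none _ (sublists leaves) (λ t t∈ → cong (_∧ P (sp l ∷ s ++ t))
                    (trans (subtree-shape l s t asc (leaf-sets t∈)) (cong (_∧ all (within l (runEnd l s)) t) isRun)))
    ... | true  = trans (cong (λ s′ → count (λ t → Q (sp l ∷ s′ ++ t)) (sublists leaves)) s≡run)
                        (trans (count-extensions-of-interval l (length s)) (cong (h l) (sym g≡)))
      where
      s≡run = isRunFrom⇒run l s (≡true⇒T isRun)
      g≡ : runEnd l s ≡ l + length s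
      g≡ = trans (cong (runEnd l) s≡run) (runEnd-run l (length s))

    count-subtrees : count Q (sublists (vertices y)) ≡ L + intervalSum h 0 (k + 2)
    count-subtrees = begin
      count Q (sublists (map sp (upTo (k + 2)) ++ leaves))
        ≡⟨ count-sublists-++ Q (map sp (upTo (k + 2))) leaves ⟩
      sum (map G (sublists (map sp (upTo (k + 2)))))
        ≡⟨ cong (λ s → sum (map G (sublists s))) spine≡run ⟩
      sum (map G (sublists (run 0 (k + 2))))
        ≡⟨ sum-map-cong G _ spine-sets (λ s s∈ → count-extensions s (Ascending-sublists (k + 2) s∈)) ⟩
      sum (map (λ s → (if null s then L else 0) + runValue h s) spine-sets)
        ≡⟨ sum-map-+ (λ s → if null s then L else 0) (runValue h) spine-sets ⟩
      sum (map (λ s → if null s then L else 0) spine-sets) + sum (map (runValue h) spine-sets)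
        ≡⟨ cong₂ _+_ (sum-sublists-[] _ (run 0 (k + 2)) (λ _ _ → refl)) (sum-runValue h 0 (k + 2)) ⟩
      L + intervalSum h 0 (k + 2) ∎
      where
      open ≡-Reasoning
      G : List Vtx → ℕ
      G s = count (λ t → Q (s ++ t)) (sublists leaves)
      spine-sets = sublists (run 0 (k + 2))

  open CountSubtrees using (count-subtrees)

  weight : ℕ → ℕ
  weight j = 2 ^ yAt y j

  count-leaves : (p : Vtx → Bool) → (∀ i t → p (lf i t) ≡ p (sp i)) →
    count p leaves ≡ sum (map (λ j → if p (sp j) then yAt y j else 0) (range 1 k))
  count-leaves p p-index = begin
    count p (concatMap block (upTo k))
      ≡⟨ count-concatMap p block (upTo k) ⟩
    sum (map (count p ∘ block) (upTo k))
      ≡⟨ cong (λ is → sum (map (count p ∘ block) is)) (upTo≡range k) ⟩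
    sum (map (count p ∘ block) (range 0 k))
      ≡⟨ cong sum (map-cong block-count (range 0 k)) ⟩
    sum (map (at ∘ suc) (range 0 k))
      ≡⟨ cong sum (map-range-suc at 0 k) ⟩
    sum (map at (range 1 k)) ∎
    where
    open ≡-Reasoning
    at : ℕ → ℕ
    at j = if p (sp j) then yAt y j else 0

    block-count : ∀ i → count p (block i) ≡ at (suc i)
    block-count i = begin
      count p (map (lf (suc i)) (upTo (yAt y (suc i))))
        ≡⟨ count-map p (lf (suc i)) (upTo (yAt y (suc i))) ⟩
      count (p ∘ lf (suc i)) (upTo (yAt y (suc i)))
        ≡⟨ count-cong _ _ (upTo (yAt y (suc i))) (λ t _ → p-index (suc i) t) ⟩
      count (λ _ → p (sp (suc i))) (upTo (yAt y (suc i)))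
        ≡⟨ count-const (p (sp (suc i))) (upTo (yAt y (suc i))) ⟩
      (if p (sp (suc i)) then length (upTo (yAt y (suc i))) else 0)
        ≡⟨ cong (λ n → if p (sp (suc i)) then n else 0) (length-applyUpTo id (yAt y (suc i))) ⟩
      at (suc i) ∎

  leavesIn : ℕ → ℕ → ℕ → ℕ
  leavesIn l g j = if within l g (sp j) then yAt y j else 0

  leafCount-sum : (l g : ℕ) → leafCount l g ≡ sum (map (leavesIn l g) (range 1 k))
  leafCount-sum l g = count-leaves (within l g) (λ _ _ → refl)

  sum-indicator-yAt : (l : ℕ) → sum (map (λ j → if j ≡ᵇ l then yAt y j else 0) (range 1 k)) ≡ yAt y l
  sum-indicator-yAt zero = trans (sum-indicator-∉ 0 (yAt y) (range 1 k) (λ j∈ → ≢-sym (<⇒≢ (proj₁ (∈-range⁻ 1 k j∈)))))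
                                 (sym (yAt-0 y))
  sum-indicator-yAt (suc l) with suc l ≤? k
  ... | yes l<k = sum-indicator-range (suc l) (yAt y) 1 k (s≤s z≤n) (s≤s l<k)
  ... | no  l≮k = trans (sum-indicator-∉ (suc l) (yAt y) (range 1 k)
                               (λ j∈ → <⇒≢ (≤-trans (proj₂ (∈-range⁻ 1 k j∈)) (≰⇒> l≮k))))
                        (sym (yAt-beyond y (≰⇒> l≮k)))

  leafCount-step : (l g : ℕ) → l ≤ g → leafCount l g ≡ yAt y l + leafCount (suc l) g
  leafCount-step l g l≤g = begin
    leafCount l g
      ≡⟨ leafCount-sum l g ⟩
    sum (map (leavesIn l g) (range 1 k))
      ≡⟨ cong sum (map-cong split (range 1 k)) ⟩
    sum (map (λ j → (if j ≡ᵇ l then yAt y j else 0) + leavesIn (suc l) g j) (range 1 k))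
      ≡⟨ sum-map-+ (λ j → if j ≡ᵇ l then yAt y j else 0) (leavesIn (suc l) g) (range 1 k) ⟩
    sum (map (λ j → if j ≡ᵇ l then yAt y j else 0) (range 1 k)) + sum (map (leavesIn (suc l) g) (range 1 k))
      ≡⟨ cong₂ _+_ (sum-indicator-yAt l) (sym (leafCount-sum (suc l) g)) ⟩
    yAt y l + leafCount (suc l) g ∎
    where
    open ≡-Reasoning
    split : ∀ j → leavesIn l g j ≡ (if j ≡ᵇ l then yAt y j else 0) + leavesIn (suc l) g j
    split j with <-cmp j l
    ... | tri< j<l _ _
      rewrite ≤ᵇ-false (<⇒≱ j<l) | ≤ᵇ-false {suc l} {j} (λ l<j → <⇒≱ j<l (<⇒≤ l<j)) | ≡ᵇ-false (<⇒≢ j<l) = refl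
    ... | tri≈ _ refl _
      rewrite ≤ᵇ-true {j} ≤-refl | ≤ᵇ-true l≤g | ≤ᵇ-false {suc j} {j} 1+n≰n | ≡ᵇ-true {j} refl = sym (+-identityʳ _)
    ... | tri> _ _ l<j
      rewrite ≤ᵇ-true (<⇒≤ l<j) | ≤ᵇ-true {suc l} l<j | ≡ᵇ-false (≢-sym (<⇒≢ l<j)) = refl

  leafCount-empty : (l g : ℕ) → g < l → leafCount l g ≡ 0
  leafCount-empty l g g<l = trans (leafCount-sum l g) (sum-map-zero (leavesIn l g) (range 1 k) (λ j _ → vanish j))
    where
    vanish : ∀ j → leavesIn l g j ≡ 0
    vanish j with l ≤? j
    ... | no  l≰j rewrite ≤ᵇ-false l≰j = refl
    ... | yes l≤j rewrite ≤ᵇ-true l≤j | ≤ᵇ-false (λ j≤g → <⇒≱ g<l (≤-trans l≤j j≤g)) = refl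

  subtreesOn-step : (l g : ℕ) → l ≤ g → subtreesOn l g ≡ weight l * subtreesOn (suc l) g
  subtreesOn-step l g l≤g = trans (cong (2 ^_) (leafCount-step l g l≤g)) (^-distribˡ-+-* 2 (yAt y l) (leafCount (suc l) g))

  subtreesOn-point : (l : ℕ) → subtreesOn l l ≡ weight l
  subtreesOn-point l = begin
    subtreesOn l l                     ≡⟨ subtreesOn-step l l ≤-refl ⟩
    weight l * 2 ^ leafCount (suc l) l ≡⟨ cong (λ n → weight l * 2 ^ n) (leafCount-empty (suc l) l ≤-refl) ⟩
    weight l * 1                       ≡⟨ *-identityʳ (weight l) ⟩
    weight l                           ∎
    where open ≡-Reasoning

  subtreesOn-product : (l n : ℕ) → subtreesOn l (l + n) ≡ product (map weight (range l (suc n)))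
  subtreesOn-product l zero    = trans (cong (subtreesOn l) (+-identityʳ l)) (trans (subtreesOn-point l) (sym (*-identityʳ (weight l))))
  subtreesOn-product l (suc n) = trans (subtreesOn-step l (l + suc n) (m≤m+n l (suc n)))
    (cong (weight l *_) (trans (cong (subtreesOn (suc l)) (+-suc l n)) (subtreesOn-product (suc l) n)))

  row-prefixProducts : (a M : ℕ) → sum (map (subtreesOn a) (range a (suc M))) ≡ prefixProducts (map weight (range a (suc M)))
  row-prefixProducts a zero    = trans (cong (_+ 0) (subtreesOn-point a)) (cong (weight a +_) (sym (*-zeroʳ (weight a))))
  row-prefixProducts a (suc M) = cong₂ _+_ (subtreesOn-point a) (begin
    sum (map (subtreesOn a) (range (suc a) (suc M)))
      ≡⟨ sum-map-cong _ _ (range (suc a) (suc M)) (λ g g∈ → subtreesOn-step a g (<⇒≤ (proj₁ (∈-range⁻ (suc a) (suc M) g∈)))) ⟩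
    sum (map (λ g → weight a * subtreesOn (suc a) g) (range (suc a) (suc M)))
      ≡⟨ sum-map-*ˡ (weight a) (subtreesOn (suc a)) (range (suc a) (suc M)) ⟩
    weight a * sum (map (subtreesOn (suc a)) (range (suc a) (suc M)))
      ≡⟨ cong (weight a *_) (row-prefixProducts (suc a) M) ⟩
    weight a * prefixProducts (map weight (range (suc a) (suc M))) ∎)
    where open ≡-Reasoning

  column-suffixProducts : (a n : ℕ) →
    sum (map (λ l → subtreesOn l (a + n)) (range a (suc n))) ≡ suffixProducts (map weight (range a (suc n)))
  column-suffixProducts a zero    = cong (_+ 0) (subtreesOn-product a 0)
  column-suffixProducts a (suc n) = cong₂ _+_ (subtreesOn-product a (suc n))
    (trans (cong (λ g → sum (map (λ l → subtreesOn l g) (range (suc a) (suc n)))) (+-suc a n)) (column-suffixProducts (suc a) n))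

  intervalSum-segmentProducts : (a m : ℕ) → intervalSum subtreesOn a m ≡ segmentProducts (map weight (range a m))
  intervalSum-segmentProducts a zero    = refl
  intervalSum-segmentProducts a (suc m) = cong₂ _+_ (row-prefixProducts a m) (intervalSum-segmentProducts (suc a) m)

  weights : List ℕ
  weights = map weight (range 0 (k + 2))

  weights≡ : weights ≡ 1 ∷ map (2 ^_) y ++ 1 ∷ []
  weights≡ = begin
    map weight (range 0 (k + 2))
      ≡⟨ cong (λ n → map weight (range 0 n)) (+-suc k 1) ⟩
    weight 0 ∷ map weight (range 1 (k + 1))
      ≡⟨ cong (λ xs → weight 0 ∷ map weight xs) (range-++ 1 k 1) ⟩
    weight 0 ∷ map weight (range 1 k ++ suc k ∷ [])
      ≡⟨ cong₂ _∷_ (cong (2 ^_) (yAt-0 y)) (map-++ weight (range 1 k) (suc k ∷ [])) ⟩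
    1 ∷ map weight (range 1 k) ++ weight (suc k) ∷ []
      ≡⟨ cong₂ (λ xs n → 1 ∷ xs ++ n ∷ []) (trans (map-∘ (range 1 k)) (cong (map (2 ^_)) (map-yAt y)))
                                          (cong (2 ^_) (yAt-beyond y ≤-refl)) ⟩
    1 ∷ map (2 ^_) y ++ 1 ∷ [] ∎
    where open ≡-Reasoning

  length-leaves : count (λ _ → true) leaves ≡ sum y
  length-leaves = trans (count-leaves (λ _ → true) (λ _ _ → refl)) (cong sum (map-yAt y))

  φ≡ : φ y ≡ sum y + segmentProducts weights
  φ≡ = begin
    φ y
      ≡⟨ count-cong isSubtree (λ S → isSubtree S ∧ true) (sublists (vertices y)) (λ S _ → sym (∧-identityʳ (isSubtree S))) ⟩
    count (λ S → isSubtree S ∧ true) (sublists (vertices y))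
      ≡⟨ count-subtrees (λ _ → true) (λ _ _ → true) (λ _ _ _ _ _ → refl) ⟩
    count (λ _ → true) leaves + intervalSum subtreesOn 0 (k + 2)
      ≡⟨ cong₂ _+_ length-leaves (intervalSum-segmentProducts 0 (k + 2)) ⟩
    sum y + segmentProducts weights ∎
    where open ≡-Reasoning

  f-as-intervalSum : (W : Vtx → Bool) (j : ℕ) (c : ℕ → ℕ → Bool) →
    (∀ l n t → (∀ {w} → w ∈ t → IsLeaf w) → T (all (within l (l + n)) t) →
       countedByF W (sp j) (spineInterval l n t) ≡ c l (l + n)) →
    f y W (sp j) ≡ intervalSum (λ l g → if c l g then subtreesOn l g else 0) 0 (k + 2)
  f-as-intervalSum W j c region = trans (count-filterᵇ _ isSubtree (sublists (vertices y)))
                                (trans (count-subtrees _ c region) (cong (_+ intervalSum _ 0 (k + 2)) leaves-avoid-spine))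
    where
    not-spine : ∀ v → IsLeaf v → (elem (sp j) (v ∷ []) ∧ all W (v ∷ [])) ≡ false
    not-spine (lf _ _) _ = refl

    leaves-avoid-spine : count (λ v → elem (sp j) (v ∷ []) ∧ all W (v ∷ [])) leaves ≡ 0
    leaves-avoid-spine = count-none _ leaves (λ v v∈ → not-spine v (leaves-are-leaves v∈))

  index<k+2 : {j : ℕ} → j ≤ k + 1 → j < k + 2
  index<k+2 j≤ = ≤-trans (s≤s j≤) (≤-reflexive (sym (+-suc k 1)))

  f-V : (j : ℕ) → j ≤ k + 1 → f y (V j) (sp j) ≡ weight j
  f-V j j≤ = begin
    f y (V j) (sp j)
      ≡⟨ f-as-intervalSum (V j) j (λ l g → (l ≡ᵇ j) ∧ (g ≡ᵇ j)) (region-V j) ⟩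
    intervalSum (λ l g → if (l ≡ᵇ j) ∧ (g ≡ᵇ j) then subtreesOn l g else 0) 0 (k + 2)
      ≡⟨ intervalSum-cong _ _ 0 (k + 2) (λ l g → if-∧ (l ≡ᵇ j) (g ≡ᵇ j) (subtreesOn l g)) ⟩
    intervalSum (λ l g → if l ≡ᵇ j then ending-at-j l g else 0) 0 (k + 2)
      ≡⟨ intervalSum-row ending-at-j j 0 (k + 2) z≤n (index<k+2 j≤) ⟩
    sum (map (ending-at-j j) (range j (k + 2 ∸ j)))
      ≡⟨ sum-indicator-range j (subtreesOn j) j (k + 2 ∸ j) ≤-refl
           (≤-trans (index<k+2 j≤) (≤-reflexive (sym (m+[n∸m]≡n (<⇒≤ (index<k+2 j≤)))))) ⟩
    subtreesOn j j
      ≡⟨ subtreesOn-point j ⟩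
    weight j ∎
    where
    open ≡-Reasoning
    ending-at-j : ℕ → ℕ → ℕ
    ending-at-j l g = if g ≡ᵇ j then subtreesOn l g else 0

  f-V≥ : (m : ℕ) → m ≤ k + 1 → f y (V≥ m) (sp m) ≡ prefixProducts (map weight (range m (suc (k + 1 ∸ m))))
  f-V≥ m m≤ = begin
    f y (V≥ m) (sp m)
      ≡⟨ f-as-intervalSum (V≥ m) m (λ l _ → l ≡ᵇ m) (region-V≥ m) ⟩
    intervalSum (λ l g → if l ≡ᵇ m then subtreesOn l g else 0) 0 (k + 2)
      ≡⟨ intervalSum-row subtreesOn m 0 (k + 2) z≤n (index<k+2 m≤) ⟩
    sum (map (subtreesOn m) (range m (k + 2 ∸ m)))
      ≡⟨ cong (λ n → sum (map (subtreesOn m) (range m n))) (trans (cong (_∸ m) (+-suc k 1)) (+-∸-assoc 1 m≤)) ⟩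
    sum (map (subtreesOn m) (range m (suc (k + 1 ∸ m))))
      ≡⟨ row-prefixProducts m (k + 1 ∸ m) ⟩
    prefixProducts (map weight (range m (suc (k + 1 ∸ m)))) ∎
    where open ≡-Reasoning

  f-V≤ : (m : ℕ) → m ≤ k + 1 → f y (V≤ m) (sp m) ≡ suffixProducts (map weight (range 0 (suc m)))
  f-V≤ m m≤ = begin
    f y (V≤ m) (sp m)
      ≡⟨ f-as-intervalSum (V≤ m) m (λ _ g → g ≡ᵇ m) (region-V≤ m) ⟩
    intervalSum (λ l g → if g ≡ᵇ m then subtreesOn l g else 0) 0 (k + 2)
      ≡⟨ intervalSum-column subtreesOn m 0 (k + 2) z≤n (index<k+2 m≤) ⟩
    sum (map (λ l → subtreesOn l m) (range 0 (suc m)))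
      ≡⟨ column-suffixProducts 0 m ⟩
    suffixProducts (map weight (range 0 (suc m))) ∎
    where open ≡-Reasoning

-- The exchange

module CentralSegment (A : ℕ → ℕ) (p : ℕ) where

  segment : ℕ → List ℕ
  segment i = map A (range (p ∸ i) (suc (i + i)))

  segment-suc : (i : ℕ) → i < p → segment (suc i) ≡ A (p ∸ suc i) ∷ segment i ++ A (p + suc i) ∷ []
  segment-suc i i<p = cong (A (p ∸ suc i) ∷_) (begin
    map A (range (suc (p ∸ suc i)) (suc i + suc i))
      ≡⟨ cong₂ (λ a n → map A (range a n)) (sym (+-∸-assoc 1 i<p)) (lemma₁ i) ⟩
    map A (range (p ∸ i) (suc (i + i) + 1))
      ≡⟨ cong (map A) (range-++ (p ∸ i) (suc (i + i)) 1) ⟩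
    map A (range (p ∸ i) (suc (i + i)) ++ (p ∸ i + suc (i + i)) ∷ [])
      ≡⟨ map-++ A (range (p ∸ i) (suc (i + i))) _ ⟩
    segment i ++ A (p ∸ i + suc (i + i)) ∷ []
      ≡⟨ cong (λ n → segment i ++ A n ∷ []) (trans (lemma₂ (p ∸ i) i) (cong (_+ suc i) (m∸n+n≡m (<⇒≤ i<p)))) ⟩
    segment i ++ A (p + suc i) ∷ [] ∎)
    where
    open ≡-Reasoning
    lemma₁ : ∀ i → suc i + suc i ≡ suc (i + i) + 1
    lemma₁ = solve-∀
    lemma₂ : ∀ a i → a + suc (i + i) ≡ a + i + suc i
    lemma₂ = solve-∀

  module _ (q : ℕ) (q<p : q < p) (positive : ∀ j → 1 ≤ A j)
           (mirror : ∀ i → 1 ≤ i → i ≤ q → A (p + i) ≤ A (p ∸ i)) where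

    inner<p : ∀ {i} → suc i ≤ q → i < p
    inner<p i<q = ≤-trans (n≤1+n _) (≤-trans (s≤s i<q) q<p)

    suffix≤prefix : ∀ i → i ≤ q → suffixProducts (segment i) ≤ prefixProducts (segment i)
    suffix≤prefix zero    _   = ≤-reflexive (lemma (A p))
      where
      lemma : ∀ x → x * 1 + 0 ≡ x + x * 0
      lemma = solve-∀
    suffix≤prefix (suc i) i<q = subst (λ L → suffixProducts L ≤ prefixProducts L) (sym (segment-suc i (inner<p i<q)))
      (suffix≤prefix-bracket _ _ (segment i) (mirror (suc i) (s≤s z≤n) i<q) (suffix≤prefix i (<⇒≤ i<q)))

    suffix<prefix : ∀ i → i ≤ q → ∀ j → 1 ≤ j → j ≤ i → A (p + j) < A (p ∸ j) →
                    suffixProducts (segment i) < prefixProducts (segment i)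
    suffix<prefix zero    _   j 1≤j j≤0 _      = ⊥-elim (1+n≰n (≤-trans 1≤j j≤0))
    suffix<prefix (suc i) i<q j 1≤j j≤i strict = subst (λ L → suffixProducts L < prefixProducts L) (sym (segment-suc i (inner<p i<q)))
      (suffix<prefix-bracket _ _ (segment i) (mirror (suc i) (s≤s z≤n) i<q) (suffix≤prefix i (<⇒≤ i<q))
                             (positive (p ∸ suc i)) here-or-inside)
      where
      here-or-inside : A (p + suc i) < A (p ∸ suc i) ⊎ suffixProducts (segment i) < prefixProducts (segment i)
      here-or-inside with m≤n⇒m<n∨m≡n j≤i
      ... | inj₂ refl      = inj₁ strict
      ... | inj₁ (s≤s j≤i′) = inj₂ (suffix<prefix i (<⇒≤ i<q) j 1≤j j≤i′ strict)

-- Reversing the block y_{r+1}, …, y_{r+2q+1} of y, whose centre is p = r + q + 1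
module Reversal (y : List ℕ) (q r s : ℕ) (length-y : length y ≡ suc (q + r) + q + s) where

  open Caterpillar y using (weight; weights; φ≡)

  width end : ℕ
  width = suc (q + q)
  end   = suc (q + r) + q + 1

  L Mid R : List ℕ
  L   = map (yAt y) (range 1 r)
  Mid = map (yAt y) (range (suc r) width)
  R   = map (yAt y) (range end s)

  y₁ : List ℕ
  y₁ = L ++ reverse Mid ++ R

  X M Z : List ℕ
  X = map weight (range 0 (suc r))
  M = map weight (range (suc r) width)
  Z = map weight (range end (suc s))

  width-end : suc r + width ≡ end
  width-end = lemma q r
    where
    lemma : ∀ q r → suc r + suc (q + q) ≡ suc (q + r) + q + 1
    lemma = solve-∀

  y-split : y ≡ L ++ Mid ++ R
  y-split = begin
    y
      ≡⟨ map-yAt y ⟨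
    map (yAt y) (range 1 (length y))
      ≡⟨ cong (λ n → map (yAt y) (range 1 n)) (trans length-y (lemma q r s)) ⟩
    map (yAt y) (range 1 (r + (width + s)))
      ≡⟨ cong (map (yAt y)) (trans (range-++ 1 r (width + s))
           (cong (range 1 r ++_) (trans (range-++ (suc r) width s) (cong (λ a → range (suc r) width ++ range a s) width-end)))) ⟩
    map (yAt y) (range 1 r ++ range (suc r) width ++ range end s)
      ≡⟨ trans (map-++ (yAt y) (range 1 r) _) (cong (L ++_) (map-++ (yAt y) (range (suc r) width) (range end s))) ⟩
    L ++ Mid ++ R ∎
    where
    open ≡-Reasoning
    lemma : ∀ q r s → suc (q + r) + q + s ≡ r + (suc (q + q) + s)
    lemma = solve-∀

  y₁↭y : y₁ ↭ y
  y₁↭y = subst (y₁ ↭_) (sym y-split) (++⁺ˡ L (++⁺ʳ R (↭-reverse Mid)))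

  weights-split : weights ≡ X ++ M ++ Z
  weights-split = begin
    map weight (range 0 (length y + 2))
      ≡⟨ cong (λ n → map weight (range 0 n)) (trans (cong (_+ 2) length-y) (lemma q r s)) ⟩
    map weight (range 0 (suc r + (width + suc s)))
      ≡⟨ cong (map weight) (trans (range-++ 0 (suc r) (width + suc s))
           (cong (range 0 (suc r) ++_) (trans (range-++ (suc r) width (suc s)) (cong (λ a → range (suc r) width ++ range a (suc s)) width-end)))) ⟩
    map weight (range 0 (suc r) ++ range (suc r) width ++ range end (suc s))
      ≡⟨ trans (map-++ weight (range 0 (suc r)) _) (cong (X ++_) (map-++ weight (range (suc r) width) (range end (suc s)))) ⟩
    X ++ M ++ Z ∎
    where
    open ≡-Reasoning
    lemma : ∀ q r s → suc (q + r) + q + s + 2 ≡ suc r + (suc (q + q) + suc s)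
    lemma = solve-∀

  Z≡ : map weight (range end s) ++ 1 ∷ [] ≡ Z
  Z≡ = begin
    map weight (range end s) ++ 1 ∷ []
      ≡⟨ cong (λ n → map weight (range end s) ++ 2 ^ n ∷ []) (yAt-beyond y (≤-reflexive (trans (cong suc length-y) (lemma q r s)))) ⟨
    map weight (range end s) ++ weight (end + s) ∷ []
      ≡⟨ map-++ weight (range end s) (end + s ∷ []) ⟨
    map weight (range end s ++ range (end + s) 1)
      ≡⟨ cong (map weight) (range-++ end s 1) ⟨
    map weight (range end (s + 1))
      ≡⟨ cong (λ n → map weight (range end n)) (+-comm s 1) ⟩
    Z ∎
    where
    open ≡-Reasoning
    lemma : ∀ q r s → suc (suc (q + r) + q + s) ≡ suc (q + r) + q + 1 + s
    lemma = solve-∀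

  weights₁-split : Caterpillar.weights y₁ ≡ X ++ reverse M ++ Z
  weights₁-split = begin
    Caterpillar.weights y₁
      ≡⟨ Caterpillar.weights≡ y₁ ⟩
    1 ∷ map (2 ^_) (L ++ reverse Mid ++ R) ++ 1 ∷ []
      ≡⟨ cong (λ xs → 1 ∷ xs ++ 1 ∷ []) (trans (map-++ (2 ^_) L _) (cong (map (2 ^_) L ++_) (map-++ (2 ^_) (reverse Mid) R))) ⟩
    1 ∷ (map (2 ^_) L ++ map (2 ^_) (reverse Mid) ++ map (2 ^_) R) ++ 1 ∷ []
      ≡⟨ cong (1 ∷_) (trans (++-assoc (map (2 ^_) L) _ _) (cong (map (2 ^_) L ++_) (++-assoc (map (2 ^_) (reverse Mid)) _ _))) ⟩
    (1 ∷ map (2 ^_) L) ++ map (2 ^_) (reverse Mid) ++ map (2 ^_) R ++ 1 ∷ []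
      ≡⟨ cong₂ (λ a b → (a ∷ map (2 ^_) L) ++ b ++ map (2 ^_) R ++ 1 ∷ []) (cong (2 ^_) (sym (yAt-0 y))) (reverse-map (2 ^_) Mid) ⟩
    (weight 0 ∷ map (2 ^_) L) ++ reverse (map (2 ^_) Mid) ++ map (2 ^_) R ++ 1 ∷ []
      ≡⟨ cong₂ (λ a b → a ++ reverse b ++ map (2 ^_) R ++ 1 ∷ []) (cong (weight 0 ∷_) (sym (map-∘ (range 1 r)))) (sym (map-∘ (range (suc r) width))) ⟩
    X ++ reverse M ++ map (2 ^_) R ++ 1 ∷ []
      ≡⟨ cong (λ a → X ++ reverse M ++ a ++ 1 ∷ []) (sym (map-∘ (range end s))) ⟩
    X ++ reverse M ++ map weight (range end s) ++ 1 ∷ []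
      ≡⟨ cong (λ a → X ++ reverse M ++ a) Z≡ ⟩
    X ++ reverse M ++ Z ∎
    where open ≡-Reasoning

  φ-decreases : suffixProducts M < prefixProducts M → prefixProducts Z < suffixProducts X → φ y₁ < φ y
  φ-decreases M-front Z<X = begin-strict
    φ y₁
      ≡⟨ Caterpillar.φ≡ y₁ ⟩
    sum y₁ + segmentProducts (Caterpillar.weights y₁)
      ≡⟨ cong₂ (λ a b → a + segmentProducts b) (sum-↭ y₁↭y) weights₁-split ⟩
    sum y + segmentProducts (X ++ reverse M ++ Z)
      <⟨ +-monoʳ-< (sum y) (reverse-middle-< X M Z M-front Z<X) ⟩
    sum y + segmentProducts (X ++ M ++ Z)
      ≡⟨ cong (λ b → sum y + segmentProducts b) weights-split ⟨
    sum y + segmentProducts weights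
      ≡⟨ φ≡ ⟨
    φ y ∎
    where open ≤-Reasoning

reversal-decreases-φ : (y : List ℕ) (p q r s : ℕ) → suc (q + r) ≡ p → length y ≡ p + q + s →
  (∀ i → 1 ≤ i → i ≤ q → f y (V (p ∸ i)) (sp (p ∸ i)) ≥ f y (V (p + i)) (sp (p + i))) →
  (∃[ i ] (1 ≤ i × i ≤ q × f y (V (p ∸ i)) (sp (p ∸ i)) > f y (V (p + i)) (sp (p + i)))) →
  f y (V≤ (p ∸ q ∸ 1)) (sp (p ∸ q ∸ 1)) > f y (V≥ (p + q + 1)) (sp (p + q + 1)) →
  ∃[ y₁ ] (y₁ ↭ y × φ y₁ < φ y)
reversal-decreases-φ y p q r s refl length-y mirror (j , 1≤j , j≤q , strict) outer =
  y₁ , y₁↭y , φ-decreases middle-front outer-weights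
  where
  open Reversal y q r s length-y
  open Caterpillar y using (weight; f-V; f-V≤; f-V≥)
  open CentralSegment weight p using (segment; suffix<prefix)

  p∸q : p ∸ q ≡ suc r
  p∸q = trans (+-∸-assoc 1 (m≤m+n q r)) (cong suc (m+n∸m≡n q r))

  p≤k+1 : p ≤ length y + 1
  p≤k+1 = ≤-trans (m≤m+n p (q + s)) (≤-trans (≤-reflexive (trans (sym (+-assoc p q s)) (sym length-y))) (m≤m+n _ 1))

  p+i≤k+1 : ∀ {i} → i ≤ q → p + i ≤ length y + 1
  p+i≤k+1 i≤q = ≤-trans (+-monoʳ-≤ p i≤q) (≤-trans (m≤m+n (p + q) s) (≤-trans (≤-reflexive (sym length-y)) (m≤m+n _ 1)))

  weight-at : ∀ i → i ≤ q → f y (V (p + i)) (sp (p + i)) ≡ weight (p + i) × f y (V (p ∸ i)) (sp (p ∸ i)) ≡ weight (p ∸ i)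
  weight-at i i≤q = f-V (p + i) (p+i≤k+1 i≤q) , f-V (p ∸ i) (≤-trans (m∸n≤m p i) p≤k+1)

  middle-front : suffixProducts M < prefixProducts M
  middle-front = subst (λ N → suffixProducts N < prefixProducts N) (cong (λ a → map weight (range a width)) p∸q)
    (suffix<prefix q (s≤s (m≤m+n q r)) (λ i → m^n>0 2 (yAt y i))
      (λ i 1≤i i≤q → subst₂ _≤_ (proj₁ (weight-at i i≤q)) (proj₂ (weight-at i i≤q)) (mirror i 1≤i i≤q))
      q ≤-refl j 1≤j j≤q (subst₂ _<_ (proj₁ (weight-at j j≤q)) (proj₂ (weight-at j j≤q)) strict))

  outer-weights : prefixProducts Z < suffixProducts X
  outer-weights = subst₂ _<_
    (trans (f-V≥ (p + q + 1) (+-monoˡ-≤ 1 (≤-trans (m≤m+n (p + q) s) (≤-reflexive (sym length-y)))))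
           (cong (λ n → prefixProducts (map weight (range end (suc n)))) (trans (cong (λ n → n + 1 ∸ (p + q + 1)) length-y) (lemma (p + q) s))))
    (trans (f-V≤ (p ∸ q ∸ 1) (≤-trans (m∸n≤m (p ∸ q) 1) (≤-trans (m∸n≤m p q) p≤k+1)))
           (cong (λ n → suffixProducts (map weight (range 0 (suc n)))) (cong (_∸ 1) p∸q)))
    outer
    where
    lemma : ∀ a s → a + s + 1 ∸ (a + 1) ≡ s
    lemma a s = trans (cong (_∸ (a + 1)) (reassociate a s)) (m+n∸m≡n (a + 1) s)
      where
      reassociate : ∀ a s → a + s + 1 ≡ a + 1 + s
      reassociate = solve-∀

lemma3p1 : (k : ℕ) (d : List ℕ) → length d ≡ k → Linked _≥_ d → All (2 ≤_) d →
    (y : List ℕ) → y ↭ map (λ x → x ∸ 2) d →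
    (p q : ℕ) → 2 ≤ p → p ≤ k ∸ 1 → 1 ≤ q → q ≤ (k ∸ p) ⊓ (p ∸ 1) →
    ((i : ℕ) → 1 ≤ i → i ≤ q → f y (V (p ∸ i)) (sp (p ∸ i)) ≥ f y (V (p + i)) (sp (p + i))) →
    (∃[ i ] (1 ≤ i × i ≤ q × f y (V (p ∸ i)) (sp (p ∸ i)) > f y (V (p + i)) (sp (p + i)))) →
    f y (V≤ (p ∸ q ∸ 1)) (sp (p ∸ q ∸ 1)) > f y (V≥ (p + q + 1)) (sp (p + q + 1)) →
    ∃[ y₁ ] (y₁ ↭ map (λ x → x ∸ 2) d × φ y₁ < φ y)
lemma3p1 k d length-d _ _ y y↭d p q 2≤p p≤k∸1 _ q≤min mirror strict outer =
  let (y₁ , y₁↭y , smaller) = reversal-decreases-φ y p q r s p≡ length-y mirror strict outer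
  in  y₁ , ↭-trans y₁↭y y↭d , smaller
  where
  q<p : q < p
  q<p = ≤-trans (s≤s (≤-trans q≤min (m⊓n≤n (k ∸ p) (p ∸ 1)))) (≤-reflexive (m+[n∸m]≡n (≤-trans (s≤s z≤n) 2≤p)))

  p+q≤k : p + q ≤ k
  p+q≤k = ≤-trans (+-monoʳ-≤ p (≤-trans q≤min (m⊓n≤m (k ∸ p) (p ∸ 1))))
                  (≤-reflexive (m+[n∸m]≡n (≤-trans p≤k∸1 (m∸n≤m k 1))))

  r = proj₁ (m≤n⇒∃[o]m+o≡n q<p)
  p≡ = proj₂ (m≤n⇒∃[o]m+o≡n q<p)
  s = proj₁ (m≤n⇒∃[o]m+o≡n p+q≤k)

  length-y : length y ≡ p + q + s
  length-y = trans (↭-length y↭d) (trans (length-map _ d) (trans length-d (sym (proj₂ (m≤n⇒∃[o]m+o≡n p+q≤k)))))
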